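{- (1) Pitassi's 1996 algebraic proof system is polynomially equivalent to Hilbert-like IPS. (2) Pitassi's 1997 algebraic proof system, i.e. Polynomial Calculus with size measured by number of lines, is polynomially equivalent to Hilbert-like $\det$-IPS (equivalently, Hilbert-like $\mathsf{VP}_{ws}$-IPS).
   Context: Let $F_1,\dots,F_m\in\mathbb F[x_1,\dots,x_n]$ have no common zero. Pitassi 1996 system: a proof is an algebraic circuit computing a tuple $(G_1(\vec x),\dots,G_m(\vec x))$ with $\sum_iF_iG_i=1$; size is circuit size. Pitassi 1997 system: a proof is a derivation of $1$ by lines, each line being some $F_i$, or $\alpha G+\beta H$ for earlier lines $G,H$ and $\alpha,\beta\in\mathbb F$, or $x_iG$ for an earlier line $G$; size is the number of lines. IPS: with placeholder variables $y_i$, a certificate is $C(\vec x,\vec y)$ with $C(\vec x,\vec0)=0$ and $C(\vec x,\vec F(\vec x))=1$; Hilbert-like means $C=\sum_iy_iG_i(\vec x)$; Hilbert-like IPS proofs are algebraic circuits computing Hilbert-like certificates, size = circuit size. Hilbert-like $\det$-IPS / $\mathsf{VP}_{ws}$-IPS: the certificate must be computed by a weakly skew circuit (fan-in 2 circuit in which, for every multiplication gate, one of its two input subcircuits is connected to the rest of the circuit only through that gate), equivalently as a projection of a determinant; size is the size of this circuit. Polynomial equivalence: each system p-simulates the other (proofs convertible with polynomial size blow-up). -}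

module Defs where

open import Level using (Level; _⊔_) renaming (suc to lsuc)
open import Algebra.Bundles using (CommutativeRing)
open import Data.Nat using (ℕ; zero; suc; _+_; _*_; _^_; _≤_)
open import Data.Fin using (Fin; zero; suc; _↑ˡ_; _↑ʳ_; splitAt)
open import Data.Product using (Σ; _×_; _,_; ∃; ∃-syntax)
open import Data.Sum using (_⊎_; inj₁; inj₂)
open import Relation.Nullary using (¬_)
open import Relation.Binary.PropositionalEquality using (_≡_)

record Field (c ℓ : Level) : Set (lsuc (c ⊔ ℓ)) where
  field
    commutativeRing : CommutativeRing c ℓ
  open CommutativeRing commutativeRing public
  field
    0≉1     : ¬ (0# ≈ 1#)
    inverse : ∀ x → ¬ (x ≈ 0#) →
              ∃[ y ] (CommutativeRing._*_ commutativeRing x y ≈ 1#)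

module Poly {c ℓ : Level} (𝔽 : Field c ℓ) where
  private module Fld = Field 𝔽
  K : Set c
  K = Fld.Carrier

  data Term (V : ℕ) : Set c where
    var : Fin V → Term V
    cst : K → Term V
    _⊕_ : Term V → Term V → Term V
    _⊗_ : Term V → Term V → Term V

  infixl 6 _⊕_
  infixl 7 _⊗_
  infix 4 _≈P_

  -- Equality in the polynomial ring K[x_1..x_V]: the congruence generated
  -- by the commutative-ring axioms and the fact that constants form a
  -- copy of K (so Term V / ≈P is the free commutative K-algebra, i.e.
  -- the polynomial ring).
  data _≈P_ {V : ℕ} : Term V → Term V → Set (c ⊔ ℓ) where
    ≈refl  : ∀ {p} → p ≈P p
    ≈sym   : ∀ {p q} → p ≈P q → q ≈P p
    ≈trans : ∀ {p q r} → p ≈P q → q ≈P r → p ≈P r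
    ⊕-cong : ∀ {p p' q q'} → p ≈P p' → q ≈P q' → p ⊕ q ≈P p' ⊕ q'
    ⊗-cong : ∀ {p p' q q'} → p ≈P p' → q ≈P q' → p ⊗ q ≈P p' ⊗ q'
    ⊕-assoc : ∀ p q r → (p ⊕ q) ⊕ r ≈P p ⊕ (q ⊕ r)
    ⊕-comm  : ∀ p q → p ⊕ q ≈P q ⊕ p
    ⊕-idˡ   : ∀ p → cst Fld.0# ⊕ p ≈P p
    ⊕-invˡ  : ∀ p → cst (Fld.- Fld.1#) ⊗ p ⊕ p ≈P cst Fld.0#
    ⊗-assoc : ∀ p q r → (p ⊗ q) ⊗ r ≈P p ⊗ (q ⊗ r)
    ⊗-comm  : ∀ p q → p ⊗ q ≈P q ⊗ p
    ⊗-idˡ   : ∀ p → cst Fld.1# ⊗ p ≈P p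
    distribˡ : ∀ p q r → p ⊗ (q ⊕ r) ≈P p ⊗ q ⊕ p ⊗ r
    cst-cong : ∀ {a b} → a Fld.≈ b → cst a ≈P cst b
    cst-+    : ∀ a b → cst (a Fld.+ b) ≈P cst a ⊕ cst b
    cst-*    : ∀ a b → cst (a Fld.* b) ≈P cst a ⊗ cst b

  subst : ∀ {V W} → (Fin V → Term W) → Term V → Term W
  subst σ (var i) = σ i
  subst σ (cst a) = cst a
  subst σ (p ⊕ q) = subst σ p ⊕ subst σ q
  subst σ (p ⊗ q) = subst σ p ⊗ subst σ q

  ∑ : ∀ {V} (m : ℕ) → (Fin m → Term V) → Term V
  ∑ zero    f = cst Fld.0#
  ∑ (suc m) f = f zero ⊕ ∑ m (λ i → f (suc i))

  -- Algebraic circuits (fan-in 2) as straight-line programs.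
  -- A gate of a circuit with s earlier gates is an input variable,
  -- a field constant, or a sum/product of two earlier gates.
  data Gate (V s : ℕ) : Set c where
    gvar : Fin V → Gate V s
    gcst : K → Gate V s
    gadd : Fin s → Fin s → Gate V s
    gmul : Fin s → Fin s → Gate V s

  data SLP (V : ℕ) : ℕ → Set c where
    []  : SLP V zero
    _▷_ : ∀ {s} → SLP V s → Gate V s → SLP V (suc s)

  eval : ∀ {V s} → SLP V s → Fin s → Term V
  eval (P ▷ gvar i)   zero    = var i
  eval (P ▷ gcst a)   zero    = cst a
  eval (P ▷ gadd a b) zero    = eval P a ⊕ eval P b
  eval (P ▷ gmul a b) zero    = eval P a ⊗ eval P b
  eval (P ▷ g)        (suc j) = eval P j
    -- NB: gate numbering: 'zero' is the last (newest) gate.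

  weakenGate : ∀ {V s} → Gate V s → Gate V (suc s)
  weakenGate (gvar i)   = gvar i
  weakenGate (gcst a)   = gcst a
  weakenGate (gadd a b) = gadd (suc a) (suc b)
  weakenGate (gmul a b) = gmul (suc a) (suc b)

  gateAt : ∀ {V s} → SLP V s → Fin s → Gate V s
  gateAt (P ▷ g) zero    = weakenGate g
  gateAt (P ▷ g) (suc j) = weakenGate (gateAt P j)

  data Input {V s : ℕ} (P : SLP V s) (u w : Fin s) : Set c where
    inAddL : ∀ {b} → gateAt P w ≡ gadd u b → Input P u w
    inAddR : ∀ {a} → gateAt P w ≡ gadd a u → Input P u w
    inMulL : ∀ {b} → gateAt P w ≡ gmul u b → Input P u w
    inMulR : ∀ {a} → gateAt P w ≡ gmul a u → Input P u w

  data Below {V s : ℕ} (P : SLP V s) (a : Fin s) : Fin s → Set c where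
    here  : Below P a a
    child : ∀ {u w} → Below P a w → Input P u w → Below P a u

  -- The subcircuit rooted at a (an input of the multiplication gate g
  -- whose other input is b) is connected to the rest of the circuit only
  -- through g: it is disjoint from b's side, a ≠ b, and every gate using
  -- a gate of the subcircuit lies in the subcircuit or is g itself.
  Detached : ∀ {V s} → SLP V s → (g a b : Fin s) → Set c
  Detached P g a b =
    ¬ (a ≡ b) × ¬ Below P a b ×
    (∀ u w → Below P a u → Input P u w → Below P a w ⊎ w ≡ g)

  WeaklySkew : ∀ {V s} → SLP V s → Set c
  WeaklySkew P = ∀ g a b → gateAt P g ≡ gmul a b →
                 Detached P g a b ⊎ Detached P g b a

  xv : ∀ {n m} → Fin n → Term (n + m)
  xv {n} {m} i = var (i ↑ˡ m)
  yv : ∀ {n m} → Fin m → Term (n + m)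
  yv {n} {m} j = var (n ↑ʳ j)

  embedX : ∀ {n m} → Term n → Term (n + m)
  embedX = subst xv

  record ProofSystem : Set (lsuc (c ⊔ ℓ)) where
    field
      Proof : (n m : ℕ) → (Fin m → Term n) → Set (c ⊔ ℓ)
      size  : ∀ {n m F} → Proof n m F → ℕ

  record P96Proof (n m : ℕ) (F : Fin m → Term n) : Set (c ⊔ ℓ) where
    field
      size    : ℕ
      circuit : SLP n size
      output  : Fin m → Fin size
      valid   : ∑ m (λ i → F i ⊗ eval circuit (output i)) ≈P cst Fld.1#

  P96 : ProofSystem
  P96 = record { Proof = P96Proof ; size = P96Proof.size }

  ySub : ∀ {n m} → (Fin m → Term n) → Fin (n + m) → Term n
  ySub {n} t v with splitAt n v
  ... | inj₁ i = var i
  ... | inj₂ j = t j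

  IsHilbertLikeCert : ∀ {n m} → (Fin m → Term n) → Term (n + m) → Set (c ⊔ ℓ)
  IsHilbertLikeCert {n} {m} F C =
    (subst (ySub {n} {m} (λ _ → cst Fld.0#)) C ≈P cst Fld.0#) ×
    (subst (ySub F) C ≈P cst Fld.1#) ×
    (Σ (Fin m → Term n) λ G →
       C ≈P ∑ m (λ j → yv {n} {m} j ⊗ embedX {n} {m} (G j)))

  record HIPSProof (n m : ℕ) (F : Fin m → Term n) : Set (c ⊔ ℓ) where
    field
      size    : ℕ
      circuit : SLP (n + m) size
      output  : Fin size
      valid   : IsHilbertLikeCert F (eval circuit output)

  HilbertIPS : ProofSystem
  HilbertIPS = record { Proof = HIPSProof ; size = HIPSProof.size }

  -- Hilbert-like det-IPS (= VP_ws-IPS): same, but the circuit must be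
  -- weakly skew.
  record HDetIPSProof (n m : ℕ) (F : Fin m → Term n) : Set (c ⊔ ℓ) where
    field
      size       : ℕ
      circuit    : SLP (n + m) size
      weaklySkew : WeaklySkew circuit
      output     : Fin size
      valid      : IsHilbertLikeCert F (eval circuit output)

  HilbertDetIPS : ProofSystem
  HilbertDetIPS = record { Proof = HDetIPSProof ; size = HDetIPSProof.size }

  data Line (n m s : ℕ) : Set c where
    axiom : Fin m → Line n m s
    lin   : K → K → Fin s → Fin s → Line n m s
    mulx  : Fin n → Fin s → Line n m s

  data Lines (n m : ℕ) : ℕ → Set c where
    []  : Lines n m zero
    _▷_ : ∀ {s} → Lines n m s → Line n m s → Lines n m (suc s)

  -- Polynomial on each line (index 'zero' = the last line).
  lineVal : ∀ {n m s} → (Fin m → Term n) → Lines n m s → Fin s → Term n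
  lineVal F (L ▷ axiom i)     zero    = F i
  lineVal F (L ▷ lin α β g h) zero    = cst α ⊗ lineVal F L g ⊕ cst β ⊗ lineVal F L h
  lineVal F (L ▷ mulx i g)    zero    = var i ⊗ lineVal F L g
  lineVal F (L ▷ _)           (suc j) = lineVal F L j

  record P97Proof (n m : ℕ) (F : Fin m → Term n) : Set (c ⊔ ℓ) where
    field
      size  : ℕ
      lines : Lines n m (suc size)
      valid : lineVal F lines zero ≈P cst Fld.1#
    numLines : ℕ
    numLines = suc size

  P97 : ProofSystem
  P97 = record { Proof = P97Proof ; size = P97Proof.numLines }

  PSimulates : ProofSystem → ProofSystem → Set (c ⊔ ℓ)
  PSimulates B A =
    ∃[ c₀ ] ∃[ k ] (∀ n m (F : Fin m → Term n) (π : ProofSystem.Proof A n m F) →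
      Σ (ProofSystem.Proof B n m F) λ π' → (ProofSystem.size B π'
                 ≤ c₀ * (ProofSystem.size A π + n + m) ^ k + c₀))

  PolyEquivalent : ProofSystem → ProofSystem → Set (c ⊔ ℓ)
  PolyEquivalent A B = PSimulates A B × PSimulates B A

-- A Pitassi-96 circuit computing G₁, …, G_m becomes the Hilbert-like certificate ∑ y_j G_j
-- with 3m + 1 further gates; conversely, setting y to the j-th unit vector in a Hilbert-like
-- certificate leaves G_j, so m copies of its circuit compute all the G_j.
--
-- Replacing every axiom F_i of a Polynomial Calculus derivation by y_i turns it into a weakly
-- skew circuit, because each multiplication is by a fresh leaf (a constant or a variable
-- x_i), and turns its last line into a Hilbert-like certificate. Conversely, let a weakly
-- skew circuit compute C = ∑ y_j G_j, and let ∂ = ∑_j F_j ∂/∂y_j at y = 0, so that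
-- ∂C = ∑ F_j G_j. Weight every gate x by w(x) = x · M(x), where M(x) is the product of the
-- other inputs of the multiplications whose detached subcircuit contains x. The output has
-- weight C, an addition has the sum of the weights of its inputs, and a multiplication
-- x = a · b with detached side a has w(a) = w(x) and M(a) = w(b). Walking down from the
-- output, Polynomial Calculus derives ∂w(x) and w(x)|_{y=0} · F_j for every gate x from the
-- same lines for M(x): a leaf only needs a multiplication by a variable or a constant, an
-- addition only linear combinations, and each gate costs m + 1 lines.

module Submission where

open import Level using (Level; _⊔_)
open import Defs
open import Algebra.Bundles using (CommutativeRing)
import Algebra.Properties.CommutativeMonoid.Sum as MonoidSum
import Algebra.Properties.Ring as RingProperties
import Algebra.Solver.Ring.NaturalCoefficients.Default as NaturalSolver
open import Data.Bool using (Bool; true; false)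
open import Data.Empty using (⊥; ⊥-elim)
open import Data.Fin as Fin using (Fin; zero; suc; toℕ; _↑ˡ_; _↑ʳ_; splitAt)
open import Data.Fin.Induction using (<-wellFounded; >-wellFounded)
open import Data.Fin.Properties
  using (splitAt-↑ˡ; splitAt-↑ʳ; splitAt⁻¹-↑ˡ; splitAt⁻¹-↑ʳ; toℕ-injective; any?; punchInᵢ≢i)
open import Data.Maybe as Maybe using (Maybe; just; nothing)
open import Data.Nat as ℕ using (ℕ; zero; suc; _≤_; _<_; z≤n; s≤s)
open import Data.Nat.Properties
  using (≤-refl; ≤-trans; ≤-reflexive; <⇒≤; <-≤-trans; ≤-<-trans; <-irrefl; m≤m+n; m≤n+m;
         +-mono-≤; +-monoʳ-≤; +-suc; *-mono-≤; *-monoˡ-≤; suc-injective)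
open import Data.Nat.Tactic.RingSolver using (solve-∀)
open import Data.Product using (Σ; _×_; _,_; proj₁; proj₂)
open import Data.Sum using (_⊎_; inj₁; inj₂; [_,_]′; swap)
open import Data.Unit using (⊤; tt)
open import Data.Vec.Functional using (_∷_; updateAt)
open import Data.Vec.Functional.Properties using (updateAt-updates; updateAt-minimal)
open import Function using (_∘_; case_of_)
import Induction.WellFounded as WF
open import Relation.Binary.PropositionalEquality as ≡ using (_≡_; refl)
import Relation.Binary.Reasoning.Setoid as SetoidReasoning
open import Relation.Nullary using (¬_; Dec; yes; no; _×-dec_)
open import Relation.Nullary.Decidable using (_⊎-dec_; map′)

module _ {c ℓ : Level} (𝔽 : Field c ℓ) where
  open Poly 𝔽
  private module Fld = Field 𝔽

  polyRing : ℕ → CommutativeRing c (c ⊔ ℓ)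
  polyRing V = record
    { Carrier = Term V ; _≈_ = _≈P_
    ; _+_ = _⊕_ ; _*_ = _⊗_ ; -_ = λ p → cst (Fld.- Fld.1#) ⊗ p
    ; 0# = cst Fld.0# ; 1# = cst Fld.1#
    ; isCommutativeRing = record
      { isRing = record
        { +-isAbelianGroup = record
          { isGroup = record
            { isMonoid = record
              { isSemigroup = record
                { isMagma = record
                  { isEquivalence = record { refl = ≈refl ; sym = ≈sym ; trans = ≈trans }
                  ; ∙-cong = ⊕-cong }
                ; assoc = ⊕-assoc }
              ; identity = ⊕-idˡ , λ p → ≈trans (⊕-comm _ _) (⊕-idˡ p) }
            ; inverse = ⊕-invˡ , λ p → ≈trans (⊕-comm _ _) (⊕-invˡ p)
            ; ⁻¹-cong = ⊗-cong ≈refl }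
          ; comm = ⊕-comm }
        ; *-cong = ⊗-cong
        ; *-assoc = ⊗-assoc
        ; *-identity = ⊗-idˡ , λ p → ≈trans (⊗-comm _ _) (⊗-idˡ p)
        ; distrib = distribˡ , λ p q r → ≈trans (⊗-comm _ _)
                      (≈trans (distribˡ p q r) (⊕-cong (⊗-comm _ _) (⊗-comm _ _))) }
      ; *-comm = ⊗-comm } }

  module PolySolver (V : ℕ) =
    NaturalSolver (CommutativeRing.commutativeSemiring (polyRing V))
      using (solve; _:=_; _:+_; _:*_)

  module ≈P-Reasoning {V : ℕ} = SetoidReasoning (CommutativeRing.setoid (polyRing V))

  module _ {V : ℕ} where
    private module R = CommutativeRing (polyRing V)

    ⊕-idʳ : (p : Term V) → p ⊕ cst Fld.0# ≈P p
    ⊕-idʳ = R.+-identityʳ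

    ⊗-idʳ : (p : Term V) → p ⊗ cst Fld.1# ≈P p
    ⊗-idʳ = R.*-identityʳ

    ⊗-zeroˡ : (p : Term V) → cst Fld.0# ⊗ p ≈P cst Fld.0#
    ⊗-zeroˡ = R.zeroˡ

    ⊗-zeroʳ : (p : Term V) → p ⊗ cst Fld.0# ≈P cst Fld.0#
    ⊗-zeroʳ = R.zeroʳ

    distribʳ : (p q r : Term V) → (q ⊕ r) ⊗ p ≈P q ⊗ p ⊕ r ⊗ p
    distribʳ = R.distribʳ

    ≡⇒≈P : {p q : Term V} → p ≡ q → p ≈P q
    ≡⇒≈P refl = ≈refl

  subst-cong : ∀ {V W} (σ : Fin V → Term W) {p q} → p ≈P q → subst σ p ≈P subst σ q
  subst-cong σ ≈refl             = ≈refl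
  subst-cong σ (≈sym e)          = ≈sym (subst-cong σ e)
  subst-cong σ (≈trans e e')     = ≈trans (subst-cong σ e) (subst-cong σ e')
  subst-cong σ (⊕-cong e e')     = ⊕-cong (subst-cong σ e) (subst-cong σ e')
  subst-cong σ (⊗-cong e e')     = ⊗-cong (subst-cong σ e) (subst-cong σ e')
  subst-cong σ (⊕-assoc p q r)   = ⊕-assoc _ _ _
  subst-cong σ (⊕-comm p q)      = ⊕-comm _ _
  subst-cong σ (⊕-idˡ p)         = ⊕-idˡ _
  subst-cong σ (⊕-invˡ p)        = ⊕-invˡ _
  subst-cong σ (⊗-assoc p q r)   = ⊗-assoc _ _ _
  subst-cong σ (⊗-comm p q)      = ⊗-comm _ _
  subst-cong σ (⊗-idˡ p)         = ⊗-idˡ _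
  subst-cong σ (distribˡ p q r)  = distribˡ _ _ _
  subst-cong σ (cst-cong e)      = cst-cong e
  subst-cong σ (cst-+ a b)       = cst-+ a b
  subst-cong σ (cst-* a b)       = cst-* a b

  subst-ext : ∀ {V W} {σ τ : Fin V → Term W} → (∀ i → σ i ≡ τ i) → ∀ p → subst σ p ≡ subst τ p
  subst-ext e (var i) = e i
  subst-ext e (cst a) = refl
  subst-ext e (p ⊕ q) = ≡.cong₂ _⊕_ (subst-ext e p) (subst-ext e q)
  subst-ext e (p ⊗ q) = ≡.cong₂ _⊗_ (subst-ext e p) (subst-ext e q)

  subst-var : ∀ {V} (p : Term V) → subst var p ≡ p
  subst-var (var i) = refl
  subst-var (cst a) = refl
  subst-var (p ⊕ q) = ≡.cong₂ _⊕_ (subst-var p) (subst-var q)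
  subst-var (p ⊗ q) = ≡.cong₂ _⊗_ (subst-var p) (subst-var q)

  subst-subst : ∀ {U V W} (σ : Fin V → Term W) (τ : Fin U → Term V) p →
                subst σ (subst τ p) ≡ subst (λ i → subst σ (τ i)) p
  subst-subst σ τ (var i) = refl
  subst-subst σ τ (cst a) = refl
  subst-subst σ τ (p ⊕ q) = ≡.cong₂ _⊕_ (subst-subst σ τ p) (subst-subst σ τ q)
  subst-subst σ τ (p ⊗ q) = ≡.cong₂ _⊗_ (subst-subst σ τ p) (subst-subst σ τ q)

  subst-∑ : ∀ {V W} (σ : Fin V → Term W) m (f : Fin m → Term V) →
            subst σ (∑ m f) ≡ ∑ m (λ j → subst σ (f j))
  subst-∑ σ zero    f = refl
  subst-∑ σ (suc m) f = ≡.cong (subst σ (f zero) ⊕_) (subst-∑ σ m (λ j → f (suc j)))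

  ySub-xv : ∀ {n m} (t : Fin m → Term n) (i : Fin n) → ySub t (i ↑ˡ m) ≡ var i
  ySub-xv {n} {m} t i rewrite splitAt-↑ˡ n i m = refl

  ySub-yv : ∀ {n m} (t : Fin m → Term n) (j : Fin m) → ySub t (n ↑ʳ j) ≡ t j
  ySub-yv {n} {m} t j rewrite splitAt-↑ʳ n m j = refl

  ySub-embedX : ∀ {n m} (t : Fin m → Term n) p → subst (ySub t) (embedX {n} {m} p) ≡ p
  ySub-embedX t p = ≡.trans (subst-subst (ySub t) xv p)
                            (≡.trans (subst-ext (ySub-xv t) p) (subst-var p))

  data VarView (n m : ℕ) : Fin (n ℕ.+ m) → Set where
    x-var : (i : Fin n) → VarView n m (i ↑ˡ m)
    y-var : (j : Fin m) → VarView n m (n ↑ʳ j)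

  varView : ∀ {n m} (v : Fin (n ℕ.+ m)) → VarView n m v
  varView {n} v with splitAt n v in eq
  ... | inj₁ i = ≡.subst (VarView n _) (splitAt⁻¹-↑ˡ eq) (x-var i)
  ... | inj₂ j = ≡.subst (VarView n _) (splitAt⁻¹-↑ʳ eq) (y-var j)

  ∑-cong : ∀ {V} m {f g : Fin m → Term V} → (∀ j → f j ≈P g j) → ∑ m f ≈P ∑ m g
  ∑-cong zero    e = ≈refl
  ∑-cong (suc m) e = ⊕-cong (e zero) (∑-cong m (λ j → e (suc j)))

  ∑-zero : ∀ {V} m {f : Fin m → Term V} → (∀ j → f j ≈P cst Fld.0#) → ∑ m f ≈P cst Fld.0#
  ∑-zero zero    e = ≈refl
  ∑-zero (suc m) e = ≈trans (⊕-cong (e zero) (∑-zero m (λ j → e (suc j)))) (⊕-idˡ _)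

  ∑-⊕ : ∀ {V} m (f g : Fin m → Term V) → ∑ m (λ j → f j ⊕ g j) ≈P ∑ m f ⊕ ∑ m g
  ∑-⊕ {V} zero    f g = ≈sym (⊕-idˡ _)
  ∑-⊕ {V} (suc m) f g =
    ≈trans (⊕-cong ≈refl (∑-⊕ m (λ j → f (suc j)) (λ j → g (suc j))))
           (solve 4 (λ a b c d → (a :+ b) :+ (c :+ d) := (a :+ c) :+ (b :+ d)) ≈refl _ _ _ _)
    where open PolySolver V

  ∑-⊗ˡ : ∀ {V} m (p : Term V) (f : Fin m → Term V) → ∑ m (λ j → p ⊗ f j) ≈P p ⊗ ∑ m f
  ∑-⊗ˡ zero    p f = ≈sym (⊗-zeroʳ p)
  ∑-⊗ˡ (suc m) p f = ≈trans (⊕-cong ≈refl (∑-⊗ˡ m p (λ j → f (suc j)))) (≈sym (distribˡ _ _ _))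

  δ : ∀ {m} → Fin m → Fin m → Fld.Carrier
  δ zero    zero    = Fld.1#
  δ zero    (suc k) = Fld.0#
  δ (suc j) zero    = Fld.0#
  δ (suc j) (suc k) = δ j k

  ∑-δ : ∀ {V} m (j : Fin m) (g : Fin m → Term V) → ∑ m (λ k → cst (δ j k) ⊗ g k) ≈P g j
  ∑-δ (suc m) zero    g = ≈trans (⊕-cong (⊗-idˡ _) (∑-zero m (λ k → ⊗-zeroˡ _))) (⊕-idʳ _)
  ∑-δ (suc m) (suc j) g = ≈trans (⊕-cong (⊗-zeroˡ _) (∑-δ m j (λ k → g (suc k)))) (⊕-idˡ _)

  valueAtOrigin : ∀ {V} → Term V → Fld.Carrier
  valueAtOrigin (var i) = Fld.0#
  valueAtOrigin (cst a) = a
  valueAtOrigin (p ⊕ q) = valueAtOrigin p Fld.+ valueAtOrigin q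
  valueAtOrigin (p ⊗ q) = valueAtOrigin p Fld.* valueAtOrigin q

  valueAtOrigin-cong : ∀ {V} {p q : Term V} → p ≈P q → valueAtOrigin p Fld.≈ valueAtOrigin q
  valueAtOrigin-cong ≈refl             = Fld.refl
  valueAtOrigin-cong (≈sym e)          = Fld.sym (valueAtOrigin-cong e)
  valueAtOrigin-cong (≈trans e e')     = Fld.trans (valueAtOrigin-cong e) (valueAtOrigin-cong e')
  valueAtOrigin-cong (⊕-cong e e')     = Fld.+-cong (valueAtOrigin-cong e) (valueAtOrigin-cong e')
  valueAtOrigin-cong (⊗-cong e e')     = Fld.*-cong (valueAtOrigin-cong e) (valueAtOrigin-cong e')
  valueAtOrigin-cong (⊕-assoc p q r)   = Fld.+-assoc _ _ _
  valueAtOrigin-cong (⊕-comm p q)      = Fld.+-comm _ _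
  valueAtOrigin-cong (⊕-idˡ p)         = Fld.+-identityˡ _
  valueAtOrigin-cong (⊕-invˡ p)        =
    Fld.trans (Fld.+-congʳ (RingProperties.-1*x≈-x Fld.ring _)) (Fld.-‿inverseˡ _)
  valueAtOrigin-cong (⊗-assoc p q r)   = Fld.*-assoc _ _ _
  valueAtOrigin-cong (⊗-comm p q)      = Fld.*-comm _ _
  valueAtOrigin-cong (⊗-idˡ p)         = Fld.*-identityˡ _
  valueAtOrigin-cong (distribˡ p q r)  = Fld.distribˡ _ _ _
  valueAtOrigin-cong (cst-cong e)      = e
  valueAtOrigin-cong (cst-+ a b)       = Fld.refl
  valueAtOrigin-cong (cst-* a b)       = Fld.refl

  cst0≉cst1 : ∀ {V} → ¬ (cst {V} Fld.0# ≈P cst Fld.1#)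
  cst0≉cst1 e = Fld.0≉1 (valueAtOrigin-cong e)

  hilbertForm : ∀ {n m} → (Fin m → Term n) → Term (n ℕ.+ m)
  hilbertForm {n} {m} G = ∑ m (λ j → yv {n} {m} j ⊗ embedX {n} {m} (G j))

  IsNullstellensatzCert : ∀ {n m} → (Fin m → Term n) → (Fin m → Term n) → Set (c ⊔ ℓ)
  IsNullstellensatzCert {m = m} F G = ∑ m (λ j → F j ⊗ G j) ≈P cst Fld.1#

  ySub-hilbertForm : ∀ {n m} (t G : Fin m → Term n) →
                     subst (ySub t) (hilbertForm G) ≈P ∑ m (λ j → t j ⊗ G j)
  ySub-hilbertForm {n} {m} t G =
    ≈trans (≡⇒≈P (subst-∑ (ySub t) m _))
           (∑-cong m (λ j → ≡⇒≈P (≡.cong₂ _⊗_ (ySub-yv t j) (ySub-embedX t (G j)))))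

  nullstellensatz⇒hilbertLike : ∀ {n m} (F G : Fin m → Term n) {C} →
    IsNullstellensatzCert F G → C ≈P hilbertForm G → IsHilbertLikeCert F C
  nullstellensatz⇒hilbertLike {m = m} F G cert C≈ =
      ≈trans (subst-cong _ C≈) (≈trans (ySub-hilbertForm _ G) (∑-zero m (λ j → ⊗-zeroˡ _)))
    , ≈trans (subst-cong _ C≈) (≈trans (ySub-hilbertForm F G) cert)
    , G , C≈

  hilbertLike⇒nullstellensatz : ∀ {n m} (F : Fin m → Term n) {C} → IsHilbertLikeCert F C →
    Σ (Fin m → Term n) λ G → (C ≈P hilbertForm G) × IsNullstellensatzCert F G
  hilbertLike⇒nullstellensatz F (_ , C[F]≈1 , G , C≈) =
    G , C≈ , ≈trans (≈sym (ySub-hilbertForm F G)) (≈trans (subst-cong _ (≈sym C≈)) C[F]≈1)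

  eval-▷-suc : ∀ {V s} (P : SLP V s) (g : Gate V s) j → eval (P ▷ g) (suc j) ≡ eval P j
  eval-▷-suc P (gvar _)   j = refl
  eval-▷-suc P (gcst _)   j = refl
  eval-▷-suc P (gadd _ _) j = refl
  eval-▷-suc P (gmul _ _) j = refl

  gateValue : ∀ {V s} → SLP V s → Gate V s → Term V
  gateValue P (gvar i)   = var i
  gateValue P (gcst a)   = cst a
  gateValue P (gadd a b) = eval P a ⊕ eval P b
  gateValue P (gmul a b) = eval P a ⊗ eval P b

  eval-gateAt : ∀ {V s} (P : SLP V s) x → eval P x ≡ gateValue P (gateAt P x)
  eval-gateAt (P ▷ gvar i)   zero    = refl
  eval-gateAt (P ▷ gcst a)   zero    = refl
  eval-gateAt (P ▷ gadd a b) zero    = refl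
  eval-gateAt (P ▷ gmul a b) zero    = refl
  eval-gateAt (P ▷ g)        (suc x) =
    ≡.trans (eval-▷-suc P g x) (≡.trans (eval-gateAt P x) (gateValue-weaken (gateAt P x)))
    where
    gateValue-weaken : ∀ h → gateValue P h ≡ gateValue (P ▷ g) (weakenGate h)
    gateValue-weaken (gvar _)   = refl
    gateValue-weaken (gcst _)   = refl
    gateValue-weaken (gadd a b) = ≡.sym (≡.cong₂ _⊕_ (eval-▷-suc P g a) (eval-▷-suc P g b))
    gateValue-weaken (gmul a b) = ≡.sym (≡.cong₂ _⊗_ (eval-▷-suc P g a) (eval-▷-suc P g b))

  eval-gate : ∀ {V s} (P : SLP V s) {x g} → gateAt P x ≡ g → eval P x ≡ gateValue P g
  eval-gate P {x} eq = ≡.trans (eval-gateAt P x) (≡.cong (gateValue P) eq)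

  Leaf : ℕ → Set c
  Leaf W = Fin W ⊎ Fld.Carrier

  leafGate : ∀ {W s} → Leaf W → Gate W s
  leafGate (inj₁ i) = gvar i
  leafGate (inj₂ a) = gcst a

  leafTerm : ∀ {W} → Leaf W → Term W
  leafTerm (inj₁ i) = var i
  leafTerm (inj₂ a) = cst a

  renameGate : ∀ {V W s} → (Fin V → Leaf W) → Gate V s → Gate W s
  renameGate ρ (gvar i)   = leafGate (ρ i)
  renameGate ρ (gcst a)   = gcst a
  renameGate ρ (gadd a b) = gadd a b
  renameGate ρ (gmul a b) = gmul a b

  renameSLP : ∀ {V W s} → (Fin V → Leaf W) → SLP V s → SLP W s
  renameSLP ρ []      = []
  renameSLP ρ (P ▷ g) = renameSLP ρ P ▷ renameGate ρ g

  eval-renameSLP : ∀ {V W s} (ρ : Fin V → Leaf W) (P : SLP V s) (i : Fin s) →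
                   eval (renameSLP ρ P) i ≡ subst (leafTerm ∘ ρ) (eval P i)
  eval-renameSLP ρ (P ▷ gvar v) zero with ρ v
  ... | inj₁ _ = refl
  ... | inj₂ _ = refl
  eval-renameSLP ρ (P ▷ gcst a)   zero    = refl
  eval-renameSLP ρ (P ▷ gadd a b) zero    = ≡.cong₂ _⊕_ (eval-renameSLP ρ P a) (eval-renameSLP ρ P b)
  eval-renameSLP ρ (P ▷ gmul a b) zero    = ≡.cong₂ _⊗_ (eval-renameSLP ρ P a) (eval-renameSLP ρ P b)
  eval-renameSLP ρ (P ▷ g)        (suc i) = begin
    eval (renameSLP ρ P ▷ renameGate ρ g) (suc i)  ≡⟨ eval-▷-suc _ (renameGate ρ g) i ⟩
    eval (renameSLP ρ P) i                         ≡⟨ eval-renameSLP ρ P i ⟩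
    subst (leafTerm ∘ ρ) (eval P i)                ≡⟨ ≡.cong (subst _) (eval-▷-suc P g i) ⟨
    subst (leafTerm ∘ ρ) (eval (P ▷ g) (suc i))    ∎
    where open ≡.≡-Reasoning

  shiftGate : ∀ {V t} s → Gate V t → Gate V (t ℕ.+ s)
  shiftGate s (gvar i)   = gvar i
  shiftGate s (gcst a)   = gcst a
  shiftGate s (gadd a b) = gadd (a ↑ˡ s) (b ↑ˡ s)
  shiftGate s (gmul a b) = gmul (a ↑ˡ s) (b ↑ˡ s)

  _++S_ : ∀ {V s t} → SLP V s → SLP V t → SLP V (t ℕ.+ s)
  P ++S []      = P
  P ++S (Q ▷ g) = (P ++S Q) ▷ shiftGate _ g

  eval-++S-↑ˡ : ∀ {V s t} (P : SLP V s) (Q : SLP V t) j → eval (P ++S Q) (j ↑ˡ s) ≡ eval Q j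
  eval-++S-↑ˡ P (Q ▷ gvar i)   zero    = refl
  eval-++S-↑ˡ P (Q ▷ gcst a)   zero    = refl
  eval-++S-↑ˡ P (Q ▷ gadd a b) zero    = ≡.cong₂ _⊕_ (eval-++S-↑ˡ P Q a) (eval-++S-↑ˡ P Q b)
  eval-++S-↑ˡ P (Q ▷ gmul a b) zero    = ≡.cong₂ _⊗_ (eval-++S-↑ˡ P Q a) (eval-++S-↑ˡ P Q b)
  eval-++S-↑ˡ P (Q ▷ g)        (suc j) =
    ≡.trans (eval-▷-suc _ (shiftGate _ g) (j ↑ˡ _))
            (≡.trans (eval-++S-↑ˡ P Q j) (≡.sym (eval-▷-suc Q g j)))

  eval-++S-↑ʳ : ∀ {V s t} (P : SLP V s) (Q : SLP V t) i → eval (P ++S Q) (t ↑ʳ i) ≡ eval P i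
  eval-++S-↑ʳ P []      i = refl
  eval-++S-↑ʳ P (Q ▷ g) i = ≡.trans (eval-▷-suc _ (shiftGate _ g) _) (eval-++S-↑ʳ P Q i)

  stack : ∀ {V s} k → (Fin k → SLP V s) → SLP V (k ℕ.* s)
  stack zero    Q = []
  stack (suc k) Q = stack k (Q ∘ suc) ++S Q zero

  stackIndex : ∀ {s} k → Fin k → Fin s → Fin (k ℕ.* s)
  stackIndex {s} (suc k) zero    i = i ↑ˡ (k ℕ.* s)
  stackIndex {s} (suc k) (suc j) i = s ↑ʳ stackIndex k j i

  eval-stack : ∀ {V s} k (Q : Fin k → SLP V s) j i → eval (stack k Q) (stackIndex k j i) ≡ eval (Q j) i
  eval-stack (suc k) Q zero    i = eval-++S-↑ˡ (stack k (Q ∘ suc)) (Q zero) i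
  eval-stack (suc k) Q (suc j) i =
    ≡.trans (eval-++S-↑ʳ (stack k (Q ∘ suc)) (Q zero) _) (eval-stack k (Q ∘ suc) j i)

  -- Pitassi 1996 proofs and Hilbert-like IPS

  record SumGadget {W s} (P : SLP W s) (k : ℕ) (y : Fin k → Fin W) (f : Fin k → Fin s) : Set c where
    field
      circuit     : SLP W (suc (k ℕ.* 3 ℕ.+ s))
      lift        : Fin s → Fin (suc (k ℕ.* 3 ℕ.+ s))
      eval-lift   : ∀ i → eval circuit (lift i) ≡ eval P i
      eval-output : eval circuit zero ≡ ∑ k (λ j → var (y j) ⊗ eval P (f j))

  sumGadget : ∀ {W s} (P : SLP W s) k y f → SumGadget P k y f
  sumGadget P zero y f = record
    { circuit = P ▷ gcst Fld.0# ; lift = suc ; eval-lift = λ _ → refl ; eval-output = refl }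
  sumGadget P (suc k) y f = record
    { circuit     = ((S.circuit ▷ gvar (y zero))
                               ▷ gmul zero (suc (S.lift (f zero))))
                               ▷ gadd zero (suc (suc zero))
    ; lift        = λ i → suc (suc (suc (S.lift i)))
    ; eval-lift   = S.eval-lift
    ; eval-output = ≡.cong₂ (λ g r → var (y zero) ⊗ g ⊕ r) (S.eval-lift (f zero)) S.eval-output }
    where module S = SumGadget (sumGadget P k (y ∘ suc) (f ∘ suc))

  p96⇒hilbertIPS : ∀ {n m F} → P96Proof n m F → HIPSProof n m F
  p96⇒hilbertIPS {n} {m} {F} π = record
    { size    = suc (m ℕ.* 3 ℕ.+ size)
    ; circuit = S.circuit
    ; output  = zero
    ; valid   = nullstellensatz⇒hilbertLike F (eval circuit ∘ output) valid C≈ }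
    where
    open P96Proof π
    module S = SumGadget (sumGadget (renameSLP (λ i → inj₁ (i ↑ˡ m)) circuit) m (n ↑ʳ_) output)
    C≈ : eval S.circuit zero ≈P hilbertForm (eval circuit ∘ output)
    C≈ = ≈trans (≡⇒≈P S.eval-output)
                (∑-cong m (λ j → ⊗-cong ≈refl (≡⇒≈P (eval-renameSLP _ circuit (output j)))))

  HilbertIPS-simulates-P96 : PSimulates HilbertIPS P96
  HilbertIPS-simulates-P96 = 3 , 1 , λ n m F π → p96⇒hilbertIPS π , size-bound (P96Proof.size π) n m
    where
    identity : ∀ s n m → suc (m ℕ.* 3 ℕ.+ s) ℕ.+ (2 ℕ.* s ℕ.+ 3 ℕ.* n ℕ.+ 2)
                         ≡ 3 ℕ.* ((s ℕ.+ n ℕ.+ m) ℕ.* 1) ℕ.+ 3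
    identity = solve-∀
    size-bound : ∀ s n m → suc (m ℕ.* 3 ℕ.+ s) ≤ 3 ℕ.* (s ℕ.+ n ℕ.+ m) ℕ.^ 1 ℕ.+ 3
    size-bound s n m = ≤-trans (m≤m+n _ _) (≤-reflexive (identity s n m))

  yUnitLeaf : ∀ {n m} → Fin m → Fin (n ℕ.+ m) → Leaf n
  yUnitLeaf {n} j v with splitAt n v
  ... | inj₁ i = inj₁ i
  ... | inj₂ k = inj₂ (δ j k)

  leafTerm-yUnitLeaf : ∀ {n m} (j : Fin m) v → leafTerm (yUnitLeaf {n} j v) ≡ ySub (cst ∘ δ j) v
  leafTerm-yUnitLeaf {n} j v with splitAt n v
  ... | inj₁ i = refl
  ... | inj₂ k = refl

  ySub-unit-hilbertForm : ∀ {n m} (G : Fin m → Term n) j → subst (ySub (cst ∘ δ j)) (hilbertForm G) ≈P G j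
  ySub-unit-hilbertForm {m = m} G j = ≈trans (ySub-hilbertForm (cst ∘ δ j) G) (∑-δ m j G)

  hilbertIPS⇒p96 : ∀ {n m F} → HIPSProof n m F → P96Proof n m F
  hilbertIPS⇒p96 {n} {m} {F} π = record
    { size    = m ℕ.* size
    ; circuit = stack m copy
    ; output  = λ j → stackIndex m j output
    ; valid   = ≈trans (∑-cong m (λ j → ⊗-cong ≈refl (copy-output j))) cert }
    where
    open HIPSProof π
    copy : Fin m → SLP n size
    copy j = renameSLP (yUnitLeaf j) circuit
    G    = proj₁ (hilbertLike⇒nullstellensatz F valid)
    C≈   = proj₁ (proj₂ (hilbertLike⇒nullstellensatz F valid))
    cert = proj₂ (proj₂ (hilbertLike⇒nullstellensatz F valid))
    copy-output : ∀ j → eval (stack m copy) (stackIndex m j output) ≈P G j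
    copy-output j = begin
      eval (stack m copy) (stackIndex m j output)   ≡⟨ eval-stack m copy j output ⟩
      eval (copy j) output                          ≡⟨ eval-renameSLP (yUnitLeaf j) circuit output ⟩
      subst (leafTerm ∘ yUnitLeaf j) (eval circuit output)
        ≡⟨ subst-ext (leafTerm-yUnitLeaf j) (eval circuit output) ⟩
      subst (ySub (cst ∘ δ j)) (eval circuit output) ≈⟨ subst-cong _ C≈ ⟩
      subst (ySub (cst ∘ δ j)) (hilbertForm G)       ≈⟨ ySub-unit-hilbertForm G j ⟩
      G j                                            ∎
      where open ≈P-Reasoning

  P96-simulates-HilbertIPS : PSimulates P96 HilbertIPS
  P96-simulates-HilbertIPS = 1 , 2 , λ n m F π → hilbertIPS⇒p96 π , size-bound (HIPSProof.size π) n m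
    where
    size-bound : ∀ s n m → m ℕ.* s ≤ 1 ℕ.* (s ℕ.+ n ℕ.+ m) ℕ.^ 2 ℕ.+ 1
    size-bound s n m = ≤-trans (*-mono-≤ (m≤n+m m (s ℕ.+ n)) (≤-trans (m≤m+n s n) (m≤m+n (s ℕ.+ n) m)))
                               (≤-trans (m≤m+n _ 1) (≤-reflexive (square (s ℕ.+ n ℕ.+ m))))
      where
      square : ∀ N → N ℕ.* N ℕ.+ 1 ≡ 1 ℕ.* (N ℕ.* (N ℕ.* 1)) ℕ.+ 1
      square = solve-∀

  Uses : ∀ {V s} → Gate V s → Fin s → Set
  Uses (gvar _)   u = ⊥
  Uses (gcst _)   u = ⊥
  Uses (gadd a b) u = u ≡ a ⊎ u ≡ b
  Uses (gmul a b) u = u ≡ a ⊎ u ≡ b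

  input⇒uses : ∀ {V s} {P : SLP V s} {u w} → Input P u w → Uses (gateAt P w) u
  input⇒uses (inAddL eq) rewrite eq = inj₁ refl
  input⇒uses (inAddR eq) rewrite eq = inj₂ refl
  input⇒uses (inMulL eq) rewrite eq = inj₁ refl
  input⇒uses (inMulR eq) rewrite eq = inj₂ refl

  uses⇒input : ∀ {V s} (P : SLP V s) {u w} → Uses (gateAt P w) u → Input P u w
  uses⇒input P {w = w} uses with gateAt P w in eq
  uses⇒input P (inj₁ refl) | gadd _ _ = inAddL eq
  uses⇒input P (inj₂ refl) | gadd _ _ = inAddR eq
  uses⇒input P (inj₁ refl) | gmul _ _ = inMulL eq
  uses⇒input P (inj₂ refl) | gmul _ _ = inMulR eq

  uses-weakenGate : ∀ {V s} (g : Gate V s) {u} → Uses (weakenGate g) u →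
                    Σ (Fin s) λ u' → u ≡ suc u' × Uses g u'
  uses-weakenGate (gadd a b) (inj₁ refl) = a , refl , inj₁ refl
  uses-weakenGate (gadd a b) (inj₂ refl) = b , refl , inj₂ refl
  uses-weakenGate (gmul a b) (inj₁ refl) = a , refl , inj₁ refl
  uses-weakenGate (gmul a b) (inj₂ refl) = b , refl , inj₂ refl

  uses-< : ∀ {V s} (P : SLP V s) w {u} → Uses (gateAt P w) u → toℕ w < toℕ u
  uses-< (P ▷ g) zero uses with uses-weakenGate g uses
  ... | _ , refl , _ = s≤s z≤n
  uses-< (P ▷ g) (suc w) uses with uses-weakenGate (gateAt P w) uses
  ... | _ , refl , uses' = s≤s (uses-< P w uses')

  uses? : ∀ {V s} (g : Gate V s) u → Dec (Uses g u)
  uses? (gvar _)   u = no λ ()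
  uses? (gcst _)   u = no λ ()
  uses? (gadd a b) u = u Fin.≟ a ⊎-dec u Fin.≟ b
  uses? (gmul a b) u = u Fin.≟ a ⊎-dec u Fin.≟ b

  below? : ∀ {V s} (P : SLP V s) a x → Dec (Below P a x)
  below? {s = s} P a = WF.All.wfRec <-wellFounded c (Dec ∘ Below P a) step
    where
    step : ∀ x → (∀ {w} → w Fin.< x → Dec (Below P a w)) → Dec (Below P a x)
    step x below<? with x Fin.≟ a | any? (λ w → user? w)
      where
      user? : ∀ w → Dec (Below P a w × Input P x w)
      user? w with uses? (gateAt P w) x
      ... | no ¬uses = no (¬uses ∘ input⇒uses ∘ proj₂)
      ... | yes uses = map′ (λ b → b , uses⇒input P uses) proj₁
                         (below<? (uses-< P w uses))
    ... | yes refl | _                     = yes here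
    ... | no _     | yes (w , below , inp) = yes (child below inp)
    ... | no x≢a   | no no-user            = no λ { here → x≢a refl
                                                  ; (child below inp) → no-user (_ , below , inp) }

  below-≤ : ∀ {V s} {P : SLP V s} {a u} → Below P a u → toℕ a ≤ toℕ u
  below-≤ here = ≤-refl
  below-≤ {P = P} (child {w = w} below input) =
    <⇒≤ (≤-<-trans (below-≤ below) (uses-< P w (input⇒uses input)))

  IsLeaf : ∀ {V s} → Gate V s → Set
  IsLeaf (gvar _)   = ⊤
  IsLeaf (gcst _)   = ⊤
  IsLeaf (gadd _ _) = ⊥
  IsLeaf (gmul _ _) = ⊥

  leaf-unused : ∀ {V s} (g : Gate V s) {u} → IsLeaf g → ¬ Uses g u
  leaf-unused (gvar _) _ ()
  leaf-unused (gcst _) _ ()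

  leaf-≢gmul : ∀ {V s} (g : Gate V s) {a b} → IsLeaf g → ¬ g ≡ gmul a b
  leaf-≢gmul (gvar _) _ ()
  leaf-≢gmul (gcst _) _ ()

  below-leaf : ∀ {V s} {P : SLP V s} {a u} → IsLeaf (gateAt P a) → Below P a u → u ≡ a
  below-leaf leaf here = refl
  below-leaf {P = P} {a} leaf (child below input) with below-leaf leaf below
  ... | refl = ⊥-elim (leaf-unused (gateAt P a) leaf (input⇒uses input))

  weakenGate-gmul : ∀ {V s} (g : Gate V s) {a b} → weakenGate g ≡ gmul a b →
                    Σ (Fin s) λ a' → Σ (Fin s) λ b' → g ≡ gmul a' b' × a ≡ suc a' × b ≡ suc b'
  weakenGate-gmul (gmul a' b') refl = a' , b' , refl , refl , refl

  isLeaf-weakenGate : ∀ {V s} (g : Gate V s) → IsLeaf g → IsLeaf (weakenGate g)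
  isLeaf-weakenGate (gvar _) _ = tt
  isLeaf-weakenGate (gcst _) _ = tt

  isLeaf-leafGate : ∀ {V s} (l : Leaf V) → IsLeaf {s = s} (leafGate l)
  isLeaf-leafGate (inj₁ _) = tt
  isLeaf-leafGate (inj₂ _) = tt

  -- From Polynomial Calculus to Hilbert-like det-IPS

  -- Gates are numbered from the newest one, so toℕ u ≡ suc (toℕ w) says that u was created
  -- right before w.
  record PrivateLeaves {V s} (P : SLP V s) (private? : Fin s → Bool) : Set c where
    field
      private-leaf      : ∀ a → private? a ≡ true → IsLeaf (gateAt P a)
      private-used-next : ∀ w u → Uses (gateAt P w) u → private? u ≡ true → toℕ u ≡ suc (toℕ w)
      mul-inputs        : ∀ g a b → gateAt P g ≡ gmul a b → private? a ≡ true × private? b ≡ false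

  privateLeaves⇒weaklySkew : ∀ {V s} {P : SLP V s} {private?} → PrivateLeaves P private? → WeaklySkew P
  privateLeaves⇒weaklySkew {P = P} {private?} inv g a b g≡ab = inj₁ (a≢b , a-not-below-b , only-via-g)
    where
    open PrivateLeaves inv
    a-private = proj₁ (mul-inputs g a b g≡ab)
    b-public  = proj₂ (mul-inputs g a b g≡ab)
    a-leaf    = private-leaf a a-private
    a≢b : ¬ a ≡ b
    a≢b refl with ≡.trans (≡.sym a-private) b-public
    ... | ()
    a-not-below-b : ¬ Below P a b
    a-not-below-b below = a≢b (≡.sym (below-leaf a-leaf below))
    g-uses-a : Uses (gateAt P g) a
    g-uses-a rewrite g≡ab = inj₁ refl
    only-via-g : ∀ u w → Below P a u → Input P u w → Below P a w ⊎ w ≡ g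
    only-via-g u w below input with below-leaf a-leaf below
    ... | refl = inj₂ (toℕ-injective (suc-injective
                   (≡.trans (≡.sym (private-used-next w a (input⇒uses input) a-private))
                            (private-used-next g a g-uses-a a-private))))

  privateLeaves-[] : ∀ {V} → PrivateLeaves {V} [] (λ ())
  privateLeaves-[] = record { private-leaf = λ () ; private-used-next = λ () ; mul-inputs = λ () }

  privateLeaves-▷ : ∀ {V s} {P : SLP V s} {private?} → PrivateLeaves P private? →
    (g : Gate V s) (flag : Bool) →
    (flag ≡ true → IsLeaf g) →
    (∀ u → Uses g u → private? u ≡ true → toℕ u ≡ 0) →
    (∀ a b → g ≡ gmul a b → private? a ≡ true × private? b ≡ false) →
    PrivateLeaves (P ▷ g) (flag ∷ private?)
  privateLeaves-▷ {P = P} inv g flag g-leaf g-uses g-mul = record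
    { private-leaf      = λ { zero p → isLeaf-weakenGate g (g-leaf p)
                            ; (suc a) p → isLeaf-weakenGate (gateAt P a) (I.private-leaf a p) }
    ; private-used-next = used-next
    ; mul-inputs        = mul-inputs }
    where
    module I = PrivateLeaves inv
    used-next : ∀ w u → Uses (gateAt (P ▷ g) w) u → (flag ∷ _) u ≡ true → toℕ u ≡ suc (toℕ w)
    used-next zero u uses p with uses-weakenGate g uses
    ... | u' , refl , uses' = ≡.cong suc (g-uses u' uses' p)
    used-next (suc w) u uses p with uses-weakenGate (gateAt P w) uses
    ... | u' , refl , uses' = ≡.cong suc (I.private-used-next w u' uses' p)
    mul-inputs : ∀ g' a b → gateAt (P ▷ g) g' ≡ gmul a b → ((flag ∷ _) a ≡ true) × ((flag ∷ _) b ≡ false)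
    mul-inputs zero a b eq with weakenGate-gmul g eq
    ... | a' , b' , eq' , refl , refl = g-mul a' b' eq'
    mul-inputs (suc w) a b eq with weakenGate-gmul (gateAt P w) eq
    ... | a' , b' , eq' , refl , refl = I.mul-inputs w a' b' eq'

  privateLeaves-leaf : ∀ {V s} {P : SLP V s} {private?} → PrivateLeaves P private? →
                       (flag : Bool) (l : Leaf V) → PrivateLeaves (P ▷ leafGate l) (flag ∷ private?)
  privateLeaves-leaf inv flag l = privateLeaves-▷ inv (leafGate l) flag
    (λ _ → isLeaf-leafGate l)
    (λ u uses → ⊥-elim (leaf-unused (leafGate l) (isLeaf-leafGate l) uses))
    (λ a b eq → ⊥-elim (leaf-≢gmul (leafGate l) (isLeaf-leafGate l) eq))

  privateLeaves-add : ∀ {V s} {P : SLP V s} {private?} → PrivateLeaves P private? → ∀ {a b} →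
                      private? a ≡ false → private? b ≡ false →
                      PrivateLeaves (P ▷ gadd a b) (false ∷ private?)
  privateLeaves-add {V} {private? = private?} inv {a} {b} a-public b-public =
    privateLeaves-▷ inv (gadd a b) false (λ ()) public-inputs (λ _ _ ())
    where
    public-inputs : ∀ u → Uses {V} (gadd a b) u → private? u ≡ true → toℕ u ≡ 0
    public-inputs u (inj₁ refl) p with ≡.trans (≡.sym a-public) p
    ... | ()
    public-inputs u (inj₂ refl) p with ≡.trans (≡.sym b-public) p
    ... | ()

  pushScaled : ∀ {V s} → SLP V s → Leaf V → Fin s → SLP V (suc (suc s))
  pushScaled P l b = (P ▷ leafGate l) ▷ gmul zero (suc b)

  privateLeaves-scaled : ∀ {V s} {P : SLP V s} {private?} → PrivateLeaves P private? → ∀ l {b} →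
                         private? b ≡ false → PrivateLeaves (pushScaled P l b) (false ∷ true ∷ private?)
  privateLeaves-scaled {V} {private? = private?} inv l {b} b-public =
    privateLeaves-▷ (privateLeaves-leaf inv true l) (gmul zero (suc b)) false (λ ()) fresh-leaf
      λ { _ _ refl → refl , b-public }
    where
    fresh-leaf : ∀ u → Uses {V} (gmul zero (suc b)) u → (true ∷ private?) u ≡ true → toℕ u ≡ 0
    fresh-leaf u (inj₁ refl) _ = refl
    fresh-leaf u (inj₂ refl) p with ≡.trans (≡.sym b-public) p
    ... | ()

  lineStep : ∀ {n m s V} → (Fin n → Term V) → (Fin m → Term V) → Line n m s → (Fin s → Term V) → Term V
  lineStep x y (axiom i)     earlier = y i
  lineStep x y (lin α β g h) earlier = cst α ⊗ earlier g ⊕ cst β ⊗ earlier h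
  lineStep x y (mulx i g)    earlier = x i ⊗ earlier g

  linesAt : ∀ {n m s V} → (Fin n → Term V) → (Fin m → Term V) → Lines n m s → Fin s → Term V
  linesAt x y (L ▷ l) zero    = lineStep x y l (linesAt x y L)
  linesAt x y (L ▷ l) (suc k) = linesAt x y L k

  lineVal≡linesAt : ∀ {n m s} (F : Fin m → Term n) (L : Lines n m s) k → lineVal F L k ≡ linesAt var F L k
  lineVal≡linesAt F (L ▷ axiom i)     zero    = refl
  lineVal≡linesAt F (L ▷ lin α β g h) zero    =
    ≡.cong₂ (λ p q → cst α ⊗ p ⊕ cst β ⊗ q) (lineVal≡linesAt F L g) (lineVal≡linesAt F L h)
  lineVal≡linesAt F (L ▷ mulx i g)    zero    = ≡.cong (var i ⊗_) (lineVal≡linesAt F L g)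
  lineVal≡linesAt F (L ▷ axiom _)     (suc k) = lineVal≡linesAt F L k
  lineVal≡linesAt F (L ▷ lin _ _ _ _) (suc k) = lineVal≡linesAt F L k
  lineVal≡linesAt F (L ▷ mulx _ _)    (suc k) = lineVal≡linesAt F L k

  mapLine : ∀ {n m s s'} → (Fin s → Fin s') → Line n m s → Line n m s'
  mapLine ι (axiom i)     = axiom i
  mapLine ι (lin α β g h) = lin α β (ι g) (ι h)
  mapLine ι (mulx i g)    = mulx i (ι g)

  lineStep-mapLine : ∀ {n m s s' V} (x : Fin n → Term V) (y : Fin m → Term V) (ι : Fin s → Fin s')
                     {v : Fin s → Term V} {v' : Fin s' → Term V} → (∀ i → v' (ι i) ≡ v i) →
                     ∀ l → lineStep x y (mapLine ι l) v' ≡ lineStep x y l v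
  lineStep-mapLine x y ι v'∘ι (axiom i)     = refl
  lineStep-mapLine x y ι v'∘ι (lin α β g h) = ≡.cong₂ (λ p q → cst α ⊗ p ⊕ cst β ⊗ q) (v'∘ι g) (v'∘ι h)
  lineStep-mapLine x y ι v'∘ι (mulx i g)    = ≡.cong (x i ⊗_) (v'∘ι g)

  appendLines : ∀ {n m s} → Lines n m s → ∀ k → (Fin k → Line n m s) → Lines n m (k ℕ.+ s)
  appendLines L zero    f = L
  appendLines L (suc k) f = appendLines L k (f ∘ suc) ▷ mapLine (k ↑ʳ_) (f zero)

  linesAt-appended-old : ∀ {n m s V} (x : Fin n → Term V) (y : Fin m → Term V) (L : Lines n m s) k f i →
                         linesAt x y (appendLines L k f) (k ↑ʳ i) ≡ linesAt x y L i
  linesAt-appended-old x y L zero    f i = refl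
  linesAt-appended-old x y L (suc k) f i = linesAt-appended-old x y L k (f ∘ suc) i

  linesAt-appended-new : ∀ {n m s V} (x : Fin n → Term V) (y : Fin m → Term V) (L : Lines n m s) k f p →
                         linesAt x y (appendLines L k f) (p ↑ˡ s) ≡ lineStep x y (f p) (linesAt x y L)
  linesAt-appended-new x y L (suc k) f zero    =
    lineStep-mapLine x y (k ↑ʳ_) (linesAt-appended-old x y L k (f ∘ suc)) (f zero)
  linesAt-appended-new x y L (suc k) f (suc p) = linesAt-appended-new x y L k (f ∘ suc) p

  -- Lines are linear in the axioms, so setting y to the j-th unit vector extracts the
  -- coefficient of y_j.
  lineCoeff : ∀ {n m s} → Lines n m s → Fin s → Fin m → Term n
  lineCoeff L k j = linesAt var (λ i → cst (δ i j)) L k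

  linesAt-linear : ∀ {n m s V} (x : Fin n → Term V) (y : Fin m → Term V) (L : Lines n m s) k →
                   linesAt x y L k ≈P ∑ m (λ j → y j ⊗ subst x (lineCoeff L k j))
  linesAt-linear {m = m} x y (L ▷ axiom i) zero =
    ≈sym (≈trans (∑-cong m (λ j → ⊗-comm _ _)) (∑-δ m i y))
  linesAt-linear {m = m} {V = V} x y (L ▷ lin α β g h) zero = begin
    cst α ⊗ linesAt x y L g ⊕ cst β ⊗ linesAt x y L h
      ≈⟨ ⊕-cong (⊗-cong ≈refl (linesAt-linear x y L g)) (⊗-cong ≈refl (linesAt-linear x y L h)) ⟩
    cst α ⊗ ∑ m (λ j → y j ⊗ c₁ j) ⊕ cst β ⊗ ∑ m (λ j → y j ⊗ c₂ j)
      ≈⟨ ⊕-cong (∑-⊗ˡ m _ _) (∑-⊗ˡ m _ _) ⟨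
    ∑ m (λ j → cst α ⊗ (y j ⊗ c₁ j)) ⊕ ∑ m (λ j → cst β ⊗ (y j ⊗ c₂ j))
      ≈⟨ ∑-⊕ m _ _ ⟨
    ∑ m (λ j → cst α ⊗ (y j ⊗ c₁ j) ⊕ cst β ⊗ (y j ⊗ c₂ j))
      ≈⟨ ∑-cong m (λ j → regroup (cst α) (cst β) (y j) (c₁ j) (c₂ j)) ⟩
    ∑ m (λ j → y j ⊗ (cst α ⊗ c₁ j ⊕ cst β ⊗ c₂ j)) ∎
    where
    open ≈P-Reasoning
    c₁ = λ j → subst x (lineCoeff L g j)
    c₂ = λ j → subst x (lineCoeff L h j)
    regroup : (a b y p q : Term V) → a ⊗ (y ⊗ p) ⊕ b ⊗ (y ⊗ q) ≈P y ⊗ (a ⊗ p ⊕ b ⊗ q)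
    regroup = solve 5 (λ a b y p q → a :* (y :* p) :+ b :* (y :* q) := y :* (a :* p :+ b :* q)) ≈refl
      where open PolySolver V
  linesAt-linear {m = m} {V = V} x y (L ▷ mulx i g) zero =
    ≈trans (⊗-cong ≈refl (linesAt-linear x y L g))
           (≈trans (≈sym (∑-⊗ˡ m _ _)) (∑-cong m (λ j → exchange (x i) (y j) _)))
    where
    exchange : (a b p : Term V) → a ⊗ (b ⊗ p) ≈P b ⊗ (a ⊗ p)
    exchange = solve 3 (λ a b p → a :* (b :* p) := b :* (a :* p)) ≈refl
      where open PolySolver V
  linesAt-linear x y (L ▷ l) (suc k) = linesAt-linear x y L k

  lineY : ∀ {n m s} → Lines n m s → Fin s → Term (n ℕ.+ m)
  lineY {n} {m} = linesAt (xv {n} {m}) (yv {n} {m})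

  lineY-hilbertForm : ∀ {n m s} (L : Lines n m s) k → lineY L k ≈P hilbertForm (lineCoeff L k)
  lineY-hilbertForm L k = linesAt-linear xv yv L k

  lineVal-nullstellensatz : ∀ {n m s} (F : Fin m → Term n) (L : Lines n m s) k →
                            lineVal F L k ≈P ∑ m (λ j → F j ⊗ lineCoeff L k j)
  lineVal-nullstellensatz {m = m} F L k =
    ≈trans (≡⇒≈P (lineVal≡linesAt F L k))
           (≈trans (linesAt-linear var F L k)
                   (∑-cong m (λ j → ⊗-cong ≈refl (≡⇒≈P (subst-var (lineCoeff L k j))))))

  record SkewTranslation {n m s} (L : Lines n m s) : Set c where
    field
      {size}          : ℕ
      circuit         : SLP (n ℕ.+ m) size
      private?        : Fin size → Bool
      privateLeaves   : PrivateLeaves circuit private?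
      lineGate        : Fin s → Fin size
      lineGate-public : ∀ k → private? (lineGate k) ≡ false
      eval-lineGate   : ∀ k → eval circuit (lineGate k) ≡ lineY L k
      size-bound      : size ≤ s ℕ.* 5

  skewTranslation : ∀ {n m s} (L : Lines n m s) → SkewTranslation L
  skewTranslation [] = record
    { circuit = [] ; private? = λ () ; privateLeaves = privateLeaves-[]
    ; lineGate = λ () ; lineGate-public = λ () ; eval-lineGate = λ () ; size-bound = z≤n }
  skewTranslation {n} (L ▷ axiom i) = record
    { circuit         = T.circuit ▷ gvar (n ↑ʳ i)
    ; private?        = false ∷ T.private?
    ; privateLeaves   = privateLeaves-leaf T.privateLeaves false (inj₁ (n ↑ʳ i))
    ; lineGate        = λ { zero → zero ; (suc k) → suc (T.lineGate k) }
    ; lineGate-public = λ { zero → refl ; (suc k) → T.lineGate-public k }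
    ; eval-lineGate   = λ { zero → refl ; (suc k) → T.eval-lineGate k }
    ; size-bound      = +-mono-≤ (s≤s z≤n) T.size-bound }
    where module T = SkewTranslation (skewTranslation L)
  skewTranslation (L ▷ lin α β g h) = record
    { circuit         = P₂ ▷ gadd (suc (suc zero)) zero
    ; private?        = false ∷ false ∷ true ∷ false ∷ true ∷ T.private?
    ; privateLeaves   = privateLeaves-add
                          (privateLeaves-scaled (privateLeaves-scaled T.privateLeaves (inj₂ α)
                                                  (T.lineGate-public g))
                                                (inj₂ β) (T.lineGate-public h))
                          refl refl
    ; lineGate        = λ { zero → zero ; (suc k) → suc (suc (suc (suc (suc (T.lineGate k))))) }
    ; lineGate-public = λ { zero → refl ; (suc k) → T.lineGate-public k }
    ; eval-lineGate   = λ { zero → ≡.cong₂ (λ p q → cst α ⊗ p ⊕ cst β ⊗ q)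
                                           (T.eval-lineGate g) (T.eval-lineGate h)
                          ; (suc k) → T.eval-lineGate k }
    ; size-bound      = +-monoʳ-≤ 5 T.size-bound }
    where
    module T = SkewTranslation (skewTranslation L)
    P₁ = pushScaled T.circuit (inj₂ α) (T.lineGate g)
    P₂ = pushScaled P₁ (inj₂ β) (suc (suc (T.lineGate h)))
  skewTranslation {n} {m} (L ▷ mulx i g) = record
    { circuit         = pushScaled T.circuit (inj₁ (i ↑ˡ m)) (T.lineGate g)
    ; private?        = false ∷ true ∷ T.private?
    ; privateLeaves   = privateLeaves-scaled T.privateLeaves (inj₁ (i ↑ˡ m)) (T.lineGate-public g)
    ; lineGate        = λ { zero → zero ; (suc k) → suc (suc (T.lineGate k)) }
    ; lineGate-public = λ { zero → refl ; (suc k) → T.lineGate-public k }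
    ; eval-lineGate   = λ { zero → ≡.cong (xv i ⊗_) (T.eval-lineGate g) ; (suc k) → T.eval-lineGate k }
    ; size-bound      = +-mono-≤ (s≤s (s≤s z≤n)) T.size-bound }
    where module T = SkewTranslation (skewTranslation L)

  p97⇒hilbertDetIPS : ∀ {n m F} → P97Proof n m F → HDetIPSProof n m F
  p97⇒hilbertDetIPS {F = F} π = record
    { size       = T.size
    ; circuit    = T.circuit
    ; weaklySkew = privateLeaves⇒weaklySkew T.privateLeaves
    ; output     = T.lineGate zero
    ; valid      = nullstellensatz⇒hilbertLike F (lineCoeff lines zero)
                     (≈trans (≈sym (lineVal-nullstellensatz F lines zero)) valid)
                     (≈trans (≡⇒≈P (T.eval-lineGate zero)) (lineY-hilbertForm lines zero)) }
    where
    open P97Proof π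
    module T = SkewTranslation (skewTranslation lines)

  HilbertDetIPS-simulates-P97 : PSimulates HilbertDetIPS P97
  HilbertDetIPS-simulates-P97 = 5 , 1 , λ n m F π →
    p97⇒hilbertDetIPS π ,
    size-bound (P97Proof.numLines π) n m (SkewTranslation.size-bound (skewTranslation (P97Proof.lines π)))
    where
    size-bound : ∀ {t} s n m → t ≤ s ℕ.* 5 → t ≤ 5 ℕ.* (s ℕ.+ n ℕ.+ m) ℕ.^ 1 ℕ.+ 5
    size-bound s n m t≤ = ≤-trans t≤ (≤-trans (m≤m+n _ _) (≤-reflexive (identity s n m)))
      where
      identity : ∀ s n m → s ℕ.* 5 ℕ.+ (5 ℕ.* n ℕ.+ 5 ℕ.* m ℕ.+ 5) ≡ 5 ℕ.* ((s ℕ.+ n ℕ.+ m) ℕ.* 1) ℕ.+ 5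
      identity = solve-∀

  -- From Hilbert-like det-IPS to Polynomial Calculus

  module Derivative {n m} (F : Fin m → Term n) where

    atY0 : Term (n ℕ.+ m) → Term n
    atY0 = subst (ySub (λ _ → cst Fld.0#))

    -- ∂ t = ∑_j F_j · (∂t/∂y_j) at y = 0, computed by the Leibniz rule.
    ∂ : Term (n ℕ.+ m) → Term n
    ∂ (var v) = [ (λ _ → cst Fld.0#) , F ]′ (splitAt n v)
    ∂ (cst a) = cst Fld.0#
    ∂ (p ⊕ q) = ∂ p ⊕ ∂ q
    ∂ (p ⊗ q) = atY0 p ⊗ ∂ q ⊕ ∂ p ⊗ atY0 q

    ∂-xv : ∀ i → ∂ (xv {n} {m} i) ≡ cst Fld.0#
    ∂-xv i rewrite splitAt-↑ˡ n i m = refl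

    ∂-yv : ∀ j → ∂ (yv {n} {m} j) ≡ F j
    ∂-yv j rewrite splitAt-↑ʳ n m j = refl

    ∂-cong : ∀ {p q} → p ≈P q → ∂ p ≈P ∂ q
    ∂-cong ≈refl            = ≈refl
    ∂-cong (≈sym e)         = ≈sym (∂-cong e)
    ∂-cong (≈trans e e')    = ≈trans (∂-cong e) (∂-cong e')
    ∂-cong (⊕-cong e e')    = ⊕-cong (∂-cong e) (∂-cong e')
    ∂-cong (⊗-cong e e')    =
      ⊕-cong (⊗-cong (subst-cong _ e) (∂-cong e')) (⊗-cong (∂-cong e) (subst-cong _ e'))
    ∂-cong (⊕-assoc p q r)  = ⊕-assoc _ _ _
    ∂-cong (⊕-comm p q)     = ⊕-comm _ _
    ∂-cong (⊕-idˡ p)        = ⊕-idˡ _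
    ∂-cong (⊕-invˡ p)       =
      ≈trans (⊕-cong (≈trans (⊕-cong ≈refl (⊗-zeroˡ _)) (⊕-idʳ _)) ≈refl) (⊕-invˡ _)
    ∂-cong (⊗-assoc p q r)  =
      solve 6 (λ zp zq zr dp dq dr →
                 zp :* zq :* dr :+ (zp :* dq :+ dp :* zq) :* zr
              := zp :* (zq :* dr :+ dq :* zr) :+ dp :* (zq :* zr)) ≈refl _ _ _ _ _ _
      where open PolySolver n
    ∂-cong (⊗-comm p q)     =
      solve 4 (λ zp zq dp dq → zp :* dq :+ dp :* zq := zq :* dp :+ dq :* zp) ≈refl _ _ _ _
      where open PolySolver n
    ∂-cong (⊗-idˡ p)        = ≈trans (⊕-cong (⊗-idˡ _) (⊗-zeroˡ _)) (⊕-idʳ _)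
    ∂-cong (distribˡ p q r) =
      solve 6 (λ zp zq zr dp dq dr →
                 zp :* (dq :+ dr) :+ dp :* (zq :+ zr)
              := (zp :* dq :+ dp :* zq) :+ (zp :* dr :+ dp :* zr)) ≈refl _ _ _ _ _ _
      where open PolySolver n
    ∂-cong (cst-cong e)     = ≈refl
    ∂-cong (cst-+ a b)      = ≈sym (⊕-idˡ _)
    ∂-cong (cst-* a b)      = ≈sym (≈trans (⊕-cong (⊗-zeroʳ _) (⊗-zeroˡ _)) (⊕-idˡ _))

    ∂-∑ : ∀ k (f : Fin k → Term (n ℕ.+ m)) → ∂ (∑ k f) ≡ ∑ k (∂ ∘ f)
    ∂-∑ zero    f = refl
    ∂-∑ (suc k) f = ≡.cong (∂ (f zero) ⊕_) (∂-∑ k (f ∘ suc))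

    ∂-hilbertForm : ∀ G → ∂ (hilbertForm G) ≈P ∑ m (λ j → F j ⊗ G j)
    ∂-hilbertForm G = ≈trans (≡⇒≈P (∂-∑ m _)) (∑-cong m term)
      where
      term : ∀ j → ∂ (yv j ⊗ embedX (G j)) ≈P F j ⊗ G j
      term j = begin
        atY0 (yv j) ⊗ ∂ (embedX (G j)) ⊕ ∂ (yv j) ⊗ atY0 (embedX (G j))
          ≡⟨ ≡.cong₂ (λ z d → z ⊗ ∂ (embedX (G j)) ⊕ d) (ySub-yv _ j)
                     (≡.cong₂ _⊗_ (∂-yv j) (ySub-embedX _ (G j))) ⟩
        cst Fld.0# ⊗ ∂ (embedX (G j)) ⊕ F j ⊗ G j
          ≈⟨ ≈trans (⊕-cong (⊗-zeroˡ _) ≈refl) (⊕-idˡ _) ⟩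
        F j ⊗ G j ∎
        where open ≈P-Reasoning

  module Product {V : ℕ} = MonoidSum (CommutativeRing.*-commutativeMonoid (polyRing V))
    using () renaming (sum to ∏; sum-cong-≋ to ∏-cong; sum-remove to ∏-remove;
                       sum-replicate-zero to ∏-ones)
  open Product

  ∏-update : ∀ {V k} (f f' : Fin k → Term V) (w : Fin k) (e : Term V) →
             f' w ≈P e ⊗ f w → (∀ g → ¬ g ≡ w → f' g ≈P f g) → ∏ f' ≈P e ⊗ ∏ f
  ∏-update {k = suc k} f f' w e f'w≈ others = begin
    ∏ f'                                  ≈⟨ ∏-remove f' ⟩
    f' w ⊗ ∏ (f' ∘ Fin.punchIn w)         ≈⟨ ⊗-cong f'w≈ (∏-cong (λ j → others _ (punchInᵢ≢i w j))) ⟩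
    (e ⊗ f w) ⊗ ∏ (f ∘ Fin.punchIn w)     ≈⟨ ⊗-assoc _ _ _ ⟩
    e ⊗ (f w ⊗ ∏ (f ∘ Fin.punchIn w))     ≈⟨ ⊗-cong ≈refl (∏-remove f) ⟨
    e ⊗ ∏ f                               ∎
    where open ≈P-Reasoning

  onlyIf : ∀ {V} {A : Set c} → Dec A → Term V → Term V
  onlyIf (yes _) t = t
  onlyIf (no _)  t = cst Fld.1#

  onlyIf-⇔ : ∀ {V} {A B : Set c} (A? : Dec A) (B? : Dec B) (t : Term V) →
             (A → B) → (B → A) → onlyIf A? t ≡ onlyIf B? t
  onlyIf-⇔ (yes _) (yes _) t _ _ = refl
  onlyIf-⇔ (yes a) (no ¬b) t f _ = ⊥-elim (¬b (f a))
  onlyIf-⇔ (no ¬a) (yes b) t _ g = ⊥-elim (¬a (g b))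
  onlyIf-⇔ (no _)  (no _)  t _ _ = refl

  module Multiplier {V s} (P : SLP V s) (weaklySkew : WeaklySkew P) (out : Fin s) where

    MulShape : Fin s → Fin s → Fin s → Set c
    MulShape g a b = gateAt P g ≡ gmul a b ⊎ gateAt P g ≡ gmul b a

    data Split (g : Fin s) : Set c where
      notMul   : (∀ a b → ¬ gateAt P g ≡ gmul a b) → Split g
      mulSplit : (a b : Fin s) → Detached P g a b → MulShape g a b → Split g

    split : ∀ g → Split g
    split g with gateAt P g in eq
    ... | gvar _   = notMul λ _ _ e → case ≡.trans (≡.sym eq) e of λ ()
    ... | gcst _   = notMul λ _ _ e → case ≡.trans (≡.sym eq) e of λ ()
    ... | gadd _ _ = notMul λ _ _ e → case ≡.trans (≡.sym eq) e of λ ()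
    ... | gmul a b = [ (λ d → mulSplit a b d (inj₁ eq)) , (λ d → mulSplit b a d (inj₂ eq)) ]′
                       (weaklySkew g a b eq)

    DetachedInputOf : ∀ {g} → Split g → Fin s → Set
    DetachedInputOf (notMul _)         u = ⊥
    DetachedInputOf (mulSplit a _ _ _) u = u ≡ a

    mulShape-uses : ∀ {g a b u} → MulShape g a b → Uses (gateAt P g) u → u ≡ a ⊎ u ≡ b
    mulShape-uses (inj₁ eq) uses rewrite eq = uses
    mulShape-uses (inj₂ eq) uses rewrite eq = swap uses

    mulShape-input : ∀ {g a b} → MulShape g a b → Input P a g × Input P b g
    mulShape-input (inj₁ eq) = inMulL eq , inMulR eq
    mulShape-input (inj₂ eq) = inMulR eq , inMulL eq

    mulShape-< : ∀ {g a b} → MulShape g a b → toℕ g < toℕ a × toℕ g < toℕ b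
    mulShape-< {g} shape = uses-< P g (input⇒uses (proj₁ (mulShape-input shape)))
                         , uses-< P g (input⇒uses (proj₂ (mulShape-input shape)))

    InScope : Fin s → Fin s → Fin s → Set c
    InScope g a y = toℕ out ≤ toℕ g × Below P a y

    inScope? : ∀ g a y → Dec (InScope g a y)
    inScope? g a y = toℕ out ℕ.≤? toℕ g ×-dec below? P a y

    -- multiplier y is the product of the inputs b of all multiplications a · b with detached
    -- side a whose subcircuit contains y. Multiplications created after out are skipped, so
    -- that multiplier out ≈ 1.
    factorAt : ∀ g → Split g → Fin s → Term V
    factorAt g (notMul _)         y = cst Fld.1#
    factorAt g (mulSplit a b _ _) y = onlyIf (inScope? g a y) (eval P b)

    factor : Fin s → Fin s → Term V
    factor g = factorAt g (split g)

    multiplier : Fin s → Term V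
    multiplier y = ∏ (λ g → factor g y)

    factor-input : ∀ {u x} → Input P u x → ∀ g → (g ≡ x → ¬ DetachedInputOf (split x) u) →
                   factor g u ≡ factor g x
    factor-input {u} {x} input g not-detached with split g in eq
    ... | notMul _ = refl
    ... | mulSplit a b (_ , a-not-below-b , only-via-g) shape =
      onlyIf-⇔ (inScope? g a u) (inScope? g a x) (eval P b) forward backward
      where
      backward : InScope g a x → InScope g a u
      backward (r , below) = r , child below input
      forward : InScope g a u → InScope g a x
      forward (r , below) with only-via-g u x below input
      ... | inj₁ below' = r , below'
      ... | inj₂ refl with mulShape-uses shape (input⇒uses input)
      ...   | inj₁ refl = ⊥-elim (not-detached refl (≡.subst (λ sp → DetachedInputOf sp u) (≡.sym eq) refl))
      ...   | inj₂ refl = ⊥-elim (a-not-below-b below)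

    multiplier-input : ∀ {u x} → Input P u x → ¬ DetachedInputOf (split x) u →
                       multiplier u ≈P multiplier x
    multiplier-input input not-detached = ∏-cong (λ g → ≡⇒≈P (factor-input input g (λ _ → not-detached)))

    multiplier-detached : ∀ {x a b d shape} → split x ≡ mulSplit a b d shape → toℕ out ≤ toℕ x →
                          multiplier a ≈P eval P b ⊗ multiplier x
    multiplier-detached {x} {a} {b} {d} {shape} eq out≤x =
      ∏-update (λ g → factor g x) (λ g → factor g a) x (eval P b) at-x others
      where
      at-x : factor x a ≈P eval P b ⊗ factor x x
      at-x rewrite eq with inScope? x a a | inScope? x a x
      ... | yes _ | no _            = ≈sym (⊗-idʳ _)
      ... | no ¬a∈ | _              = ⊥-elim (¬a∈ (out≤x , here))
      ... | yes _ | yes (_ , below) =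
        ⊥-elim (<-irrefl refl (<-≤-trans (proj₁ (mulShape-< shape)) (below-≤ below)))
      others : ∀ g → ¬ g ≡ x → factor g a ≈P factor g x
      others g g≢x = ≡⇒≈P (factor-input (proj₁ (mulShape-input shape)) g (λ g≡x → ⊥-elim (g≢x g≡x)))

    multiplier-out : multiplier out ≈P cst Fld.1#
    multiplier-out = ≈trans (∏-cong factor-out) (∏-ones s)
      where
      factor-out : ∀ g → factor g out ≈P cst Fld.1#
      factor-out g with split g
      ... | notMul _ = ≈refl
      ... | mulSplit a b _ shape with inScope? g a out
      ...   | no _ = ≈refl
      ...   | yes (out≤g , below) =
        ⊥-elim (<-irrefl refl (≤-<-trans out≤g (<-≤-trans (proj₁ (mulShape-< shape)) (below-≤ below))))

  justCount : ∀ {a} {A : Set a} → Maybe A → ℕ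
  justCount (just _) = 1
  justCount nothing  = 0

  countJust : ∀ {a} {A : Set a} {s} → (Fin s → Maybe A) → ℕ
  countJust {s = zero}  f = 0
  countJust {s = suc s} f = justCount (f zero) ℕ.+ countJust (f ∘ suc)

  countJust-≤ : ∀ {a} {A : Set a} {s} (f : Fin s → Maybe A) → countJust f ≤ s
  countJust-≤ {s = zero}  f = z≤n
  countJust-≤ {s = suc s} f = +-mono-≤ (justCount-≤1 (f zero)) (countJust-≤ (f ∘ suc))
    where
    justCount-≤1 : ∀ o → justCount o ≤ 1
    justCount-≤1 (just _) = s≤s z≤n
    justCount-≤1 nothing  = z≤n

  countJust-nothing : ∀ {a} {A : Set a} s → countJust {A = A} {s = s} (λ _ → nothing) ≡ 0
  countJust-nothing zero    = refl
  countJust-nothing (suc s) = countJust-nothing s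

  countJust-map : ∀ {a b} {A : Set a} {B : Set b} {s} (h : A → B) (f : Fin s → Maybe A) →
                  countJust (Maybe.map h ∘ f) ≡ countJust f
  countJust-map {s = zero}  h f = refl
  countJust-map {s = suc s} h f = ≡.cong₂ ℕ._+_ (justCount-map (f zero)) (countJust-map h (f ∘ suc))
    where
    justCount-map : ∀ o → justCount (Maybe.map h o) ≡ justCount o
    justCount-map (just _) = refl
    justCount-map nothing  = refl

  countJust-updateAt : ∀ {a} {A : Set a} {s} (f : Fin s → Maybe A) x (v : A) → f x ≡ nothing →
                       countJust (updateAt f x (λ _ → just v)) ≡ suc (countJust f)
  countJust-updateAt {s = suc s} f zero    v fx≡nothing rewrite fx≡nothing = refl
  countJust-updateAt {s = suc s} f (suc x) v fx≡nothing =
    ≡.trans (≡.cong (justCount (f zero) ℕ.+_) (countJust-updateAt (f ∘ suc) x v fx≡nothing))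
            (+-suc (justCount (f zero)) _)

  module WeaklySkewToLines {n m s} (F : Fin m → Term n) (P : SLP (n ℕ.+ m) s)
                    (weaklySkew : WeaklySkew P) (out : Fin s) where
    open Derivative F
    open Multiplier P weaklySkew out

    weighted : Fin s → Term (n ℕ.+ m)
    weighted x = eval P x ⊗ multiplier x

    val : ∀ {sz} → Lines n m sz → Fin sz → Term n
    val = linesAt var F

    record Handle (sz : ℕ) : Set where
      field
        scaledLine : Fin m → Fin sz
        derivLine  : Fin sz

    record Represents {sz} (L : Lines n m sz) (h : Handle sz) (t : Term (n ℕ.+ m)) : Set (c ⊔ ℓ) where
      field
        scaled : ∀ j → val L (Handle.scaledLine h j) ≈P atY0 t ⊗ F j
        deriv  : val L (Handle.derivLine h) ≈P ∂ t

    represents-cong : ∀ {sz} {L : Lines n m sz} {h t t'} → t ≈P t' → Represents L h t → Represents L h t'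
    represents-cong t≈t' r = record
      { scaled = λ j → ≈trans (Represents.scaled r j) (⊗-cong (subst-cong _ t≈t') ≈refl)
      ; deriv  = ≈trans (Represents.deriv r) (∂-cong t≈t') }

    record _≼_ {sz sz'} (L : Lines n m sz) (L' : Lines n m sz') : Set c where
      field
        lift     : Fin sz → Fin sz'
        val-lift : ∀ i → val L' (lift i) ≡ val L i

    ≼-refl : ∀ {sz} {L : Lines n m sz} → L ≼ L
    ≼-refl = record { lift = λ i → i ; val-lift = λ _ → refl }

    ≼-trans : ∀ {s₁ s₂ s₃} {L₁ : Lines n m s₁} {L₂ : Lines n m s₂} {L₃ : Lines n m s₃} →
              L₁ ≼ L₂ → L₂ ≼ L₃ → L₁ ≼ L₃
    ≼-trans e₁ e₂ = record
      { lift     = _≼_.lift e₂ ∘ _≼_.lift e₁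
      ; val-lift = λ i → ≡.trans (_≼_.val-lift e₂ _) (_≼_.val-lift e₁ i) }

    liftHandle : ∀ {sz sz'} {L : Lines n m sz} {L' : Lines n m sz'} → L ≼ L' → Handle sz → Handle sz'
    liftHandle e h = record { scaledLine = lift ∘ Handle.scaledLine h
                            ; derivLine  = lift (Handle.derivLine h) }
      where open _≼_ e

    represents-lift : ∀ {sz sz'} {L : Lines n m sz} {L' : Lines n m sz'} (e : L ≼ L') {h t} →
                      Represents L h t → Represents L' (liftHandle e h) t
    represents-lift e r = record
      { scaled = λ j → ≈trans (≡⇒≈P (val-lift _)) (Represents.scaled r j)
      ; deriv  = ≈trans (≡⇒≈P (val-lift _)) (Represents.deriv r) }
      where open _≼_ e

    ≼-appendLines : ∀ {sz} (L : Lines n m sz) k f → L ≼ appendLines L k f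
    ≼-appendLines L k f = record { lift = k ↑ʳ_ ; val-lift = linesAt-appended-old var F L k f }

    record State : Set (c ⊔ ℓ) where
      field
        {size}     : ℕ
        lines      : Lines n m size
        memo       : Fin s → Maybe (Handle size)
        memo-sound : ∀ x {h} → memo x ≡ just h → Represents lines h (weighted x)
        size-bound : size ≤ suc (countJust memo) ℕ.* suc m

    record Visited (st : State) (x : Fin s) : Set (c ⊔ ℓ) where
      field
        state      : State
        extends    : State.lines st ≼ State.lines state
        handle     : Handle (State.size state)
        represents : Represents (State.lines state) handle (weighted x)

    visited-extend : ∀ {st st' x} → State.lines st ≼ State.lines st' → Visited st' x → Visited st x
    visited-extend e r = record { Visited r ; extends = ≼-trans e (Visited.extends r) }

    visited-cong : ∀ {st y x} → weighted y ≈P weighted x → Visited st y → Visited st x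
    visited-cong y≈x r = record { Visited r ; represents = represents-cong y≈x (Visited.represents r) }

    -- Each gate is emitted at most once, which bounds the number of lines.
    emit : (st : State) (x : Fin s) (t : Term (n ℕ.+ m)) → t ≈P weighted x →
           let open State st in (f : Fin (suc m) → Line n m size) →
           lineStep var F (f zero) (val lines) ≈P ∂ t →
           (∀ j → lineStep var F (f (suc j)) (val lines) ≈P atY0 t ⊗ F j) →
           Visited st x
    emit st x t t≈ f deriv scaled with State.memo st x in memo-x
    ... | just h  = record { state = st ; extends = ≼-refl ; handle = h
                           ; represents = State.memo-sound st x memo-x }
    ... | nothing = record
      { state      = record { lines = lines' ; memo = memo' ; memo-sound = memo-sound'
                            ; size-bound = size-bound' }
      ; extends    = extension
      ; handle     = new
      ; represents = represents-new }
      where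
      open State st
      lines'    = appendLines lines (suc m) f
      extension = ≼-appendLines lines (suc m) f
      new : Handle (suc m ℕ.+ size)
      new = record { scaledLine = λ j → suc j ↑ˡ size ; derivLine = zero }
      represents-new : Represents lines' new (weighted x)
      represents-new = represents-cong t≈ record
        { scaled = λ j → ≈trans (≡⇒≈P (linesAt-appended-new var F lines (suc m) f (suc j))) (scaled j)
        ; deriv  = ≈trans (≡⇒≈P (linesAt-appended-new var F lines (suc m) f zero)) deriv }
      lifted = Maybe.map (liftHandle extension) ∘ memo
      memo'  = updateAt lifted x (λ _ → just new)
      memo-sound' : ∀ y {h} → memo' y ≡ just h → Represents lines' h (weighted y)
      memo-sound' y memo'-y with y Fin.≟ x
      ... | yes refl with ≡.trans (≡.sym (updateAt-updates x lifted)) memo'-y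
      ...   | refl = represents-new
      memo-sound' y memo'-y | no y≢x
        with memo y in memo-y | ≡.trans (≡.sym (updateAt-minimal y x lifted y≢x)) memo'-y
      ...   | just h₀ | refl = represents-lift extension (memo-sound y memo-y)
      size-bound' : suc m ℕ.+ size ≤ suc (countJust memo') ℕ.* suc m
      size-bound' rewrite countJust-updateAt lifted x new (≡.cong (Maybe.map _) memo-x)
                        | countJust-map (liftHandle extension) memo = +-monoʳ-≤ (suc m) size-bound

    lin-scale : ∀ {sz} (v : Fin sz → Term n) a g → lineStep var F (lin a Fld.0# g g) v ≈P cst a ⊗ v g
    lin-scale v a g = ≈trans (⊕-cong ≈refl (⊗-zeroˡ _)) (⊕-idʳ _)

    lin-sum : ∀ {sz} (v : Fin sz → Term n) g h → lineStep var F (lin Fld.1# Fld.1# g h) v ≈P v g ⊕ v h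
    lin-sum v g h = ⊕-cong (⊗-idˡ _) (⊗-idˡ _)

    Visitor : Fin s → Set (c ⊔ ℓ)
    Visitor x = (st : State) (k : Handle (State.size st)) →
                Represents (State.lines st) k (multiplier x) → toℕ out ≤ toℕ x → Visited st x

    visitConst : ∀ {x a} → gateAt P x ≡ gcst a → Visitor x
    visitConst {x} {a} gate st k hk _ =
      emit st x (cst a ⊗ multiplier x) (⊗-cong (≡⇒≈P (≡.sym (eval-gate P gate))) ≈refl) f deriv scaled
      where
      open State st
      open Handle k
      f : Fin (suc m) → Line n m size
      f zero    = lin a Fld.0# derivLine derivLine
      f (suc j) = lin a Fld.0# (scaledLine j) (scaledLine j)
      deriv : lineStep var F (f zero) (val lines) ≈P ∂ (cst a ⊗ multiplier x)
      deriv = ⊕-cong (⊗-cong ≈refl (Represents.deriv hk)) (≈trans (⊗-zeroˡ _) (≈sym (⊗-zeroˡ _)))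
      scaled : ∀ j → lineStep var F (f (suc j)) (val lines) ≈P atY0 (cst a ⊗ multiplier x) ⊗ F j
      scaled j = ≈trans (lin-scale (val lines) a (scaledLine j))
                        (≈trans (⊗-cong ≈refl (Represents.scaled hk j)) (≈sym (⊗-assoc _ _ _)))

    visitX : ∀ {x i} → gateAt P x ≡ gvar (i ↑ˡ m) → Visitor x
    visitX {x} {i} gate st k hk _ =
      emit st x (xv i ⊗ multiplier x) (⊗-cong (≡⇒≈P (≡.sym (eval-gate P gate))) ≈refl) f deriv scaled
      where
      open State st
      open Handle k
      open ≈P-Reasoning
      f : Fin (suc m) → Line n m size
      f zero    = mulx i derivLine
      f (suc j) = mulx i (scaledLine j)
      deriv : lineStep var F (f zero) (val lines) ≈P ∂ (xv i ⊗ multiplier x)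
      deriv = begin
        var i ⊗ val lines derivLine                                ≈⟨ ⊗-cong ≈refl (Represents.deriv hk) ⟩
        var i ⊗ ∂ (multiplier x)                                   ≈⟨ ⊕-idʳ _ ⟨
        var i ⊗ ∂ (multiplier x) ⊕ cst Fld.0#                      ≈⟨ ⊕-cong ≈refl (⊗-zeroˡ _) ⟨
        var i ⊗ ∂ (multiplier x) ⊕ cst Fld.0# ⊗ atY0 (multiplier x)
          ≡⟨ ≡.cong₂ (λ z d → z ⊗ ∂ (multiplier x) ⊕ d ⊗ atY0 (multiplier x)) (ySub-xv _ i) (∂-xv i) ⟨
        ∂ (xv i ⊗ multiplier x)                                    ∎
      scaled : ∀ j → lineStep var F (f (suc j)) (val lines) ≈P atY0 (xv i ⊗ multiplier x) ⊗ F j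
      scaled j = begin
        var i ⊗ val lines (scaledLine j)          ≈⟨ ⊗-cong ≈refl (Represents.scaled hk j) ⟩
        var i ⊗ (atY0 (multiplier x) ⊗ F j)       ≈⟨ ⊗-assoc _ _ _ ⟨
        var i ⊗ atY0 (multiplier x) ⊗ F j
          ≡⟨ ≡.cong (λ z → z ⊗ atY0 (multiplier x) ⊗ F j) (ySub-xv _ i) ⟨
        atY0 (xv i ⊗ multiplier x) ⊗ F j          ∎

    visitY : ∀ {x j'} → gateAt P x ≡ gvar (n ↑ʳ j') → Visitor x
    visitY {x} {j'} gate st k hk _ =
      emit st x (yv j' ⊗ multiplier x) (⊗-cong (≡⇒≈P (≡.sym (eval-gate P gate))) ≈refl) f deriv scaled
      where
      open State st
      open Handle k
      open ≈P-Reasoning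
      f : Fin (suc m) → Line n m size
      f zero    = lin Fld.1# Fld.0# (scaledLine j') (scaledLine j')
      f (suc j) = lin Fld.0# Fld.0# derivLine derivLine
      deriv : lineStep var F (f zero) (val lines) ≈P ∂ (yv j' ⊗ multiplier x)
      deriv = begin
        lineStep var F (f zero) (val lines)
          ≈⟨ ≈trans (lin-scale (val lines) _ (scaledLine j')) (⊗-idˡ _) ⟩
        val lines (scaledLine j')                ≈⟨ Represents.scaled hk j' ⟩
        atY0 (multiplier x) ⊗ F j'               ≈⟨ ⊗-comm _ _ ⟩
        F j' ⊗ atY0 (multiplier x)               ≈⟨ ⊕-idˡ _ ⟨
        cst Fld.0# ⊕ F j' ⊗ atY0 (multiplier x)  ≈⟨ ⊕-cong (⊗-zeroˡ _) ≈refl ⟨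
        cst Fld.0# ⊗ ∂ (multiplier x) ⊕ F j' ⊗ atY0 (multiplier x)
          ≡⟨ ≡.cong₂ (λ z d → z ⊗ ∂ (multiplier x) ⊕ d ⊗ atY0 (multiplier x)) (ySub-yv _ j') (∂-yv j') ⟨
        ∂ (yv j' ⊗ multiplier x)                 ∎
      scaled : ∀ j → lineStep var F (f (suc j)) (val lines) ≈P atY0 (yv j' ⊗ multiplier x) ⊗ F j
      scaled j = begin
        lineStep var F (f (suc j)) (val lines)
          ≈⟨ ≈trans (lin-scale (val lines) _ derivLine) (⊗-zeroˡ _) ⟩
        cst Fld.0#                                ≈⟨ ≈trans (⊗-cong (⊗-zeroˡ _) ≈refl) (⊗-zeroˡ _) ⟨
        cst Fld.0# ⊗ atY0 (multiplier x) ⊗ F j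
          ≡⟨ ≡.cong (λ z → z ⊗ atY0 (multiplier x) ⊗ F j) (ySub-yv _ j') ⟨
        atY0 (yv j' ⊗ multiplier x) ⊗ F j         ∎

    Recursion : Fin s → Set (c ⊔ ℓ)
    Recursion x = ∀ {y} → x Fin.< y → Visitor y

    notMul-¬detached : ∀ {x} → (∀ a b → ¬ gateAt P x ≡ gmul a b) → ∀ u → ¬ DetachedInputOf (split x) u
    notMul-¬detached {x} not-mul u with split x
    ... | notMul _                = λ ()
    ... | mulSplit a b _ (inj₁ eq) = ⊥-elim (not-mul a b eq)
    ... | mulSplit a b _ (inj₂ eq) = ⊥-elim (not-mul b a eq)

    visitAdd : ∀ {x a b} → gateAt P x ≡ gadd a b → Recursion x → Visitor x
    visitAdd {x} {a} {b} gate recurse st k hk out≤x =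
      visited-extend (≼-trans (Visited.extends Ra) (Visited.extends Rb))
                     (emit st₂ x (weighted a ⊕ weighted b) sum≈ f deriv scaled)
      where
      open ≈P-Reasoning
      not-mul : ∀ a' b' → ¬ gateAt P x ≡ gmul a' b'
      not-mul a' b' eq = case ≡.trans (≡.sym gate) eq of λ ()
      x<a = uses-< P x (input⇒uses {P = P} (inAddL gate))
      x<b = uses-< P x (input⇒uses {P = P} (inAddR gate))
      Ma≈Mx = multiplier-input (inAddL gate) (notMul-¬detached not-mul a)
      Mb≈Mx = multiplier-input (inAddR gate) (notMul-¬detached not-mul b)
      Ra = recurse x<a st k (represents-cong (≈sym Ma≈Mx) hk) (≤-trans out≤x (<⇒≤ x<a))
      Rb = recurse x<b (Visited.state Ra) (liftHandle (Visited.extends Ra) k)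
             (represents-cong (≈sym Mb≈Mx) (represents-lift (Visited.extends Ra) hk))
             (≤-trans out≤x (<⇒≤ x<b))
      st₂ = Visited.state Rb
      ha  = liftHandle (Visited.extends Rb) (Visited.handle Ra)
      hb  = Visited.handle Rb
      module Ha = Represents (represents-lift (Visited.extends Rb) (Visited.represents Ra))
      module Hb = Represents (Visited.represents Rb)
      f : Fin (suc m) → Line n m (State.size st₂)
      f zero    = lin Fld.1# Fld.1# (Handle.derivLine ha) (Handle.derivLine hb)
      f (suc j) = lin Fld.1# Fld.1# (Handle.scaledLine ha j) (Handle.scaledLine hb j)
      sum≈ : weighted a ⊕ weighted b ≈P weighted x
      sum≈ = begin
        eval P a ⊗ multiplier a ⊕ eval P b ⊗ multiplier b
          ≈⟨ ⊕-cong (⊗-cong ≈refl Ma≈Mx) (⊗-cong ≈refl Mb≈Mx) ⟩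
        eval P a ⊗ multiplier x ⊕ eval P b ⊗ multiplier x  ≈⟨ distribʳ _ _ _ ⟨
        (eval P a ⊕ eval P b) ⊗ multiplier x               ≡⟨ ≡.cong (_⊗ multiplier x) (eval-gate P gate) ⟨
        weighted x                                         ∎
      deriv : lineStep var F (f zero) (val (State.lines st₂)) ≈P ∂ (weighted a ⊕ weighted b)
      deriv = ≈trans (lin-sum (val (State.lines st₂)) _ _) (⊕-cong Ha.deriv Hb.deriv)
      scaled : ∀ j → lineStep var F (f (suc j)) (val (State.lines st₂)) ≈P
                     atY0 (weighted a ⊕ weighted b) ⊗ F j
      scaled j = ≈trans (lin-sum (val (State.lines st₂)) _ _)
                        (≈trans (⊕-cong (Ha.scaled j) (Hb.scaled j)) (≈sym (distribʳ _ _ _)))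

    mulShape-eval : ∀ {g a b} → MulShape g a b → eval P g ≈P eval P a ⊗ eval P b
    mulShape-eval (inj₁ eq) = ≡⇒≈P (eval-gate P eq)
    mulShape-eval (inj₂ eq) = ≈trans (≡⇒≈P (eval-gate P eq)) (⊗-comm _ _)

    visitMul : ∀ {x a b d shape} → split x ≡ mulSplit a b d shape → Recursion x → Visitor x
    visitMul {x} {a} {b} {d} {shape} split-x recurse st k hk out≤x =
      visited-extend (Visited.extends Rb) (visited-cong product≈ Ra)
      where
      open ≈P-Reasoning
      -- The other input b is processed first, since its weight is the multiplier of a.
      b-not-detached : ¬ DetachedInputOf (split x) b
      b-not-detached rewrite split-x = λ b≡a → proj₁ d (≡.sym b≡a)
      Mb≈Mx = multiplier-input (proj₂ (mulShape-input shape)) b-not-detached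
      Ma≈ = multiplier-detached split-x out≤x
      Rb = recurse (proj₂ (mulShape-< shape)) st k (represents-cong (≈sym Mb≈Mx) hk)
             (≤-trans out≤x (<⇒≤ (proj₂ (mulShape-< shape))))
      Ra = recurse (proj₁ (mulShape-< shape)) (Visited.state Rb) (Visited.handle Rb)
             (represents-cong (≈trans (⊗-cong ≈refl Mb≈Mx) (≈sym Ma≈)) (Visited.represents Rb))
             (≤-trans out≤x (<⇒≤ (proj₁ (mulShape-< shape))))
      product≈ : weighted a ≈P weighted x
      product≈ = begin
        eval P a ⊗ multiplier a                ≈⟨ ⊗-cong ≈refl Ma≈ ⟩
        eval P a ⊗ (eval P b ⊗ multiplier x)   ≈⟨ ⊗-assoc _ _ _ ⟨
        eval P a ⊗ eval P b ⊗ multiplier x     ≈⟨ ⊗-cong (mulShape-eval shape) ≈refl ⟨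
        weighted x                             ∎

    visit : ∀ x → Visitor x
    visit = WF.All.wfRec >-wellFounded (c ⊔ ℓ) Visitor step
      where
      step : ∀ x → Recursion x → Visitor x
      step x recurse with gateAt P x in gate
      ... | gcst _ = visitConst gate
      ... | gvar v with varView {n} {m} v
      ...   | x-var _ = visitX gate
      ...   | y-var _ = visitY gate
      step x recurse | gadd _ _ = visitAdd gate recurse
      step x recurse | gmul a b with split x in split-x
      ...   | notMul not-mul    = ⊥-elim (not-mul a b gate)
      ...   | mulSplit _ _ _ _ = visitMul split-x recurse

    -- The line 0 · F_j₀ stands for ∂ 1 = 0; writing it needs an axiom, hence m > 0.
    start : Fin m → State
    start j₀ = record
      { lines      = appendLines [] m axiom ▷ lin Fld.0# Fld.0# (j₀ ↑ˡ 0) (j₀ ↑ˡ 0)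
      ; memo       = λ _ → nothing
      ; memo-sound = λ _ ()
      ; size-bound = ≤-reflexive (≡.cong (λ c → suc c ℕ.* suc m) (≡.sym (countJust-nothing s))) }

    startHandle : Handle (suc (m ℕ.+ 0))
    startHandle = record { scaledLine = λ j → suc (j ↑ˡ 0) ; derivLine = zero }

    start-represents : ∀ j₀ → Represents (State.lines (start j₀)) startHandle (multiplier out)
    start-represents j₀ = represents-cong (≈sym multiplier-out) record
      { scaled = λ j → ≈trans (≡⇒≈P (linesAt-appended-new var F [] m axiom j)) (≈sym (⊗-idˡ _))
      ; deriv  = ≈trans (lin-scale (val (appendLines [] m axiom)) Fld.0# (j₀ ↑ˡ 0)) (⊗-zeroˡ _) }

    record Derivation : Set (c ⊔ ℓ) where
      field
        {size}     : ℕ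
        lines      : Lines n m size
        final      : Fin size
        final-val  : val lines final ≈P ∂ (weighted out)
        size-bound : size ≤ suc s ℕ.* suc m

    derivation : Fin m → Derivation
    derivation j₀ = record
      { lines      = State.lines st
      ; final      = Handle.derivLine (Visited.handle R)
      ; final-val  = Represents.deriv (Visited.represents R)
      ; size-bound = ≤-trans (State.size-bound st) (*-monoˡ-≤ (suc m) (s≤s (countJust-≤ (State.memo st)))) }
      where
      R  = visit out (start j₀) startHandle (start-represents j₀) ≤-refl
      st = Visited.state R

  hilbertDetIPS⇒p97 : ∀ {n m F} (π : HDetIPSProof n m F) →
    Σ (P97Proof n m F) λ π' → P97Proof.numLines π' ≤ suc (suc (HDetIPSProof.size π) ℕ.* suc m)
  hilbertDetIPS⇒p97 {m = zero} {F} π =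
    ⊥-elim (cst0≉cst1 (proj₂ (proj₂ (hilbertLike⇒nullstellensatz F (HDetIPSProof.valid π)))))
  hilbertDetIPS⇒p97 {m = suc m} {F} π =
    record { size = D.size ; lines = D.lines ▷ lin Fld.1# Fld.0# D.final D.final ; valid = valid' } ,
    s≤s D.size-bound
    where
    open HDetIPSProof π
    open Derivative F
    open Multiplier circuit weaklySkew output
    open WeaklySkewToLines F circuit weaklySkew output
    module D = Derivation (derivation zero)
    open ≈P-Reasoning
    G    = proj₁ (hilbertLike⇒nullstellensatz F valid)
    C≈   = proj₁ (proj₂ (hilbertLike⇒nullstellensatz F valid))
    cert = proj₂ (proj₂ (hilbertLike⇒nullstellensatz F valid))
    valid' : lineVal F (D.lines ▷ lin Fld.1# Fld.0# D.final D.final) zero ≈P cst Fld.1#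
    valid' = begin
      lineVal F (D.lines ▷ lin Fld.1# Fld.0# D.final D.final) zero
        ≈⟨ ≈trans (lin-scale (lineVal F D.lines) Fld.1# D.final) (⊗-idˡ _) ⟩
      lineVal F D.lines D.final             ≡⟨ lineVal≡linesAt F D.lines D.final ⟩
      val D.lines D.final                   ≈⟨ D.final-val ⟩
      ∂ (eval circuit output ⊗ multiplier output)
        ≈⟨ ∂-cong (⊗-cong (≈refl {p = eval circuit output}) multiplier-out) ⟩
      ∂ (eval circuit output ⊗ cst Fld.1#)  ≈⟨ ∂-cong (≈trans (⊗-idʳ _) C≈) ⟩
      ∂ (hilbertForm G)                     ≈⟨ ∂-hilbertForm G ⟩
      ∑ (suc m) (λ j → F j ⊗ G j)           ≈⟨ cert ⟩
      cst Fld.1#                            ∎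

  P97-simulates-HilbertDetIPS : PSimulates P97 HilbertDetIPS
  P97-simulates-HilbertDetIPS = 4 , 2 , λ n m F π →
    proj₁ (hilbertDetIPS⇒p97 π) , ≤-trans (proj₂ (hilbertDetIPS⇒p97 π)) (size-bound (HDetIPSProof.size π) n m)
    where
    square-bound : ∀ N → suc (suc N ℕ.* suc N) ≤ 4 ℕ.* (N ℕ.* (N ℕ.* 1)) ℕ.+ 4
    square-bound zero    = s≤s (s≤s z≤n)
    square-bound (suc k) = ≤-trans (m≤m+n _ (3 ℕ.* (k ℕ.* k) ℕ.+ 4 ℕ.* k ℕ.+ 3)) (≤-reflexive (identity k))
      where
      identity : ∀ k → suc (suc (suc k) ℕ.* suc (suc k)) ℕ.+ (3 ℕ.* (k ℕ.* k) ℕ.+ 4 ℕ.* k ℕ.+ 3)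
                       ≡ 4 ℕ.* (suc k ℕ.* (suc k ℕ.* 1)) ℕ.+ 4
      identity = solve-∀
    size-bound : ∀ s n m → suc (suc s ℕ.* suc m) ≤ 4 ℕ.* (s ℕ.+ n ℕ.+ m) ℕ.^ 2 ℕ.+ 4
    size-bound s n m =
      ≤-trans (s≤s (*-mono-≤ (s≤s (≤-trans (m≤m+n s n) (m≤m+n _ m))) (s≤s (m≤n+m m (s ℕ.+ n)))))
                               (square-bound (s ℕ.+ n ℕ.+ m))

proposition2p2 : ∀ {c ℓ} (𝔽 : Field c ℓ) →
    Poly.PolyEquivalent 𝔽 (Poly.P96 𝔽) (Poly.HilbertIPS 𝔽) ×
    Poly.PolyEquivalent 𝔽 (Poly.P97 𝔽) (Poly.HilbertDetIPS 𝔽)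
proposition2p2 𝔽 = (P96-simulates-HilbertIPS 𝔽 , HilbertIPS-simulates-P96 𝔽)
                 , (P97-simulates-HilbertDetIPS 𝔽 , HilbertDetIPS-simulates-P97 𝔽)
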